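{- Let $S$ be a finite totally ordered set, $R$ a commutative ring with $1$, $q\in R$, $A=R\langle t_s\mid s\in S\rangle$, $J\subseteq S$ and $s\in S$. Write $f\to g$ for "$f$ reduces to $g$ modulo $\mathcal{G}_q(\emptyset)=\{t_r^2-q\ (r\in S),\ t_rt_p+t_pt_r-2q\ (p<r)\}$". (1) If $s\in J$, then $t_s t^+_J\to q\,t^-_J$ and $t_s t^-_J\to t^+_J$. (2) If $s\notin J$, let $J'=\{j\in J\mid j<s\}$. Then $t_st^+_J\to(-1)^{\#J'}t^+_{J\cup\{s\}}+q\,t^-_J$ and $t_st^-_J\to(-1)^{\#J'-1}t^-_{J\cup\{s\}}+t^+_J$.
   Context: For $J=\{j_1<\dots<j_{\#J}\}$, $t_J=t_{j_1}\cdots t_{j_{\#J}}$; for $I=\{j_{\alpha_1}<\dots<j_{\alpha_{\#I}}\}\subseteq J$, $\ell_J(I)=\sum_\nu(\alpha_\nu-\nu)$; $t^-_J=\sum_{I\subseteq J,\ \#I\text{ odd}}(-1)^{\ell_J(I)}(-q)^{(\#I-1)/2}t_{J\setminus I}$, $t^+_J=\sum_{I\subseteq J,\ \#I\text{ even}}(-1)^{\ell_J(I)}(-q)^{\#I/2}t_{J\setminus I}$. Monomials are ordered by deglex (shorter first, equal length compared lexicographically via the order on $S$); the leading monomial of $t_r^2-q$ is $t_r^2$ and of $t_rt_p+t_pt_r-2q$ ($p<r$) is $t_rt_p$. A reduction of $f$ modulo a set $\mathcal{I}$ of polynomials with leading coefficient $1$ replaces, in some term $c\,u\,m\,v$ of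 $f$ with $m$ the leading monomial of some $g\in\mathcal{I}$, the subword $m$ by $m-g$; $f$ reduces to $h$ if a finite (possibly empty) sequence of reductions leads from $f$ to $h$. -}

module Defs where

open import Level using (_⊔_)
open import Algebra.Bundles using (CommutativeRing)
open import Data.Nat as ℕ using (ℕ; zero; suc)
open import Data.Bool using (Bool; true; false; if_then_else_)
open import Data.Fin as Fin using (Fin; zero; suc; _<_; _<?_)
open import Data.Fin.Subset using (Subset)
open import Data.Vec using ([]; _∷_)
open import Data.List as List using (List; []; _∷_; _++_; map; concatMap; filter; length)
open import Data.List.Properties using (≡-dec)
open import Data.Product using (Σ; _×_; _,_)
open import Relation.Nullary using (yes; no)
open import Relation.Binary.PropositionalEquality using (_≡_)

elems : ∀ {n} → Subset n → List (Fin n)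
elems {zero} [] = []
elems {suc n} (true ∷ p) = zero ∷ map suc (elems p)
elems {suc n} (false ∷ p) = map suc (elems p)

-- All lists of booleans of length k (all subsets I of a k-element list J,
-- true at position α meaning j_α ∈ I).
choices : ℕ → List (List Bool)
choices zero = [] ∷ []
choices (suc k) = concatMap (λ bs → (true ∷ bs) ∷ (false ∷ bs) ∷ []) (choices k)

count : List Bool → ℕ
count [] = 0
count (true ∷ bs) = suc (count bs)
count (false ∷ bs) = count bs

-- the positions α_1 < α_2 < ... (1-based) of the chosen elements, starting at position i
positions : ℕ → List Bool → List ℕ
positions i [] = []
positions i (true ∷ bs) = i ∷ positions (suc i) bs
positions i (false ∷ bs) = positions (suc i) bs

ellAux : ℕ → List ℕ → ℕ
ellAux ν [] = 0
ellAux ν (α ∷ αs) = (α ℕ.∸ ν) ℕ.+ ellAux (suc ν) αs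

ell : List Bool → ℕ
ell bs = ellAux 1 (positions 1 bs)

complementWord : ∀ {n} → List (Fin n) → List Bool → List (Fin n)
complementWord [] _ = []
complementWord (j ∷ js) [] = j ∷ js
complementWord (j ∷ js) (true ∷ bs) = complementWord js bs
complementWord (j ∷ js) (false ∷ bs) = j ∷ complementWord js bs

odd : ℕ → Bool
odd zero = false
odd (suc k) = if odd k then false else true

module FreeAlg {c ℓ} (R : CommutativeRing c ℓ) (n : ℕ) where
  open CommutativeRing R

  -- words in the generators t_s (s ∈ S = Fin n, with its natural total order)
  Word : Set
  Word = List (Fin n)

  -- elements of A = R⟨t_s | s ∈ S⟩ as formal finite sums of terms c·w
  Poly : Set c
  Poly = List (Carrier × Word)

  coeff : Poly → Word → Carrier
  coeff [] w = 0#
  coeff ((a , u) ∷ f) w with ≡-dec Fin._≟_ u w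
  ... | yes _ = a + coeff f w
  ... | no _ = coeff f w

  _≃_ : Poly → Poly → Set ℓ
  f ≃ g = ∀ w → coeff f w ≈ coeff g w

  _⊕_ : Poly → Poly → Poly
  f ⊕ g = f ++ g

  _·_ : Carrier → Poly → Poly
  a · f = map (λ { (b , w) → (a * b , w) }) f

  ⊖_ : Poly → Poly
  ⊖ f = map (λ { (b , w) → (- b , w) }) f

  sandwich : Word → Poly → Word → Poly
  sandwich u f v = map (λ { (b , w) → (b , u ++ w ++ v) }) f

  mono : Word → Poly
  mono w = (1# , w) ∷ []

  t_⊛_ : Fin n → Poly → Poly
  t s ⊛ f = sandwich (s ∷ []) f []

  pow : Carrier → ℕ → Carrier
  pow x zero = 1#
  pow x (suc k) = x * pow x k

  sgn : ℕ → Carrier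
  sgn k = pow (- 1#) k

  tMinus : Carrier → Subset n → Poly
  tMinus q J = concatMap term (choices (length (elems J)))
    where
    term : List Bool → Poly
    term bs = if odd (count bs)
              then ((sgn (ell bs) * pow (- q) (ℕ._/_ (count bs ℕ.∸ 1) 2)) , complementWord (elems J) bs) ∷ []
              else []

  tPlus : Carrier → Subset n → Poly
  tPlus q J = concatMap term (choices (length (elems J)))
    where
    term : List Bool → Poly
    term bs = if odd (count bs)
              then []
              else ((sgn (ell bs) * pow (- q) (ℕ._/_ (count bs) 2)) , complementWord (elems J) bs) ∷ []

  data Gen : Set where
    sq   : (r : Fin n) → Gen
    anti : (p r : Fin n) → p < r → Gen

  lm : Gen → Word
  lm (sq r) = r ∷ r ∷ []
  lm (anti p r _) = r ∷ p ∷ []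

  gpoly : Carrier → Gen → Poly
  gpoly q (sq r) = (1# , r ∷ r ∷ []) ∷ (- q , []) ∷ []
  gpoly q (anti p r _) = (1# , r ∷ p ∷ []) ∷ (1# , p ∷ r ∷ []) ∷ (- (q + q) , []) ∷ []

  -- one reduction: in the term c·u m v of f (c the coefficient of u m v in f),
  -- m = lm g, replace m by m - g, i.e. f ↦ f - c·u g v
  Step : Carrier → Poly → Poly → Set ℓ
  Step q f f' = Σ Gen λ g → Σ Word λ u → Σ Word λ v →
    f' ≃ (f ⊕ (⊖ (coeff f (u ++ lm g ++ v) · sandwich u (gpoly q g) v)))

  data Reduces (q : Carrier) : Poly → Poly → Set (c ⊔ ℓ) where
    done : ∀ {f h} → f ≃ h → Reduces q f h
    step : ∀ {f f' h} → Step q f f' → Reduces q f' h → Reduces q f h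

#below : ∀ {n} → Subset n → Fin n → ℕ
#below J s = length (filter (_<? s) (elems J))

module Submission where

-- Words whose letters strictly increase contain no leading monomial t_r t_r
-- or t_r t_p (p < r), so polynomials supported on them are irreducible; t^±_J
-- are such polynomials.  For an increasing word w the word t_s w reduces to an
-- explicit normal form nf w: t_s travels to the right, each smaller letter x
-- costing t_s t_x → -t_x t_s + 2q, and t_s t_s → q.  Reductions act R-linearly,
-- so t_s f reduces to NF f = Σ b·nf(w) for every f = Σ b·w in normal form
-- (reduces-to-NF).  What remains is an identity in A between NF t^±_J and the
-- claimed right-hand sides, proved by induction on the letters of J below s
-- from the recursion  t^+_{jK} = t_j t^+_K - q t^-_K,  t^-_{jK} = -t_j t^-_K + t^+_K.

open import Defs
open import Algebra.Bundles using (CommutativeRing)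
open import Algebra.Solver.Ring.AlmostCommutativeRing using (fromCommutativeRing; _-Raw-AlmostCommutative⟶_)
open import Data.Bool using (Bool; true; false; if_then_else_)
open import Data.Empty using (⊥-elim)
open import Data.Fin as Fin using (Fin; zero; suc; _<?_)
import Data.Fin.Properties as Fin
open import Data.Fin.Subset using (Subset; _∈_; _∉_; _∪_; ⁅_⁆)
open import Data.Fin.Subset.Properties using (∪-identityʳ)
open import Data.Integer as ℤ using (ℤ; +_; -[1+_]; sign; ∣_∣; _◃_; _⊖_)
import Data.Integer.Properties as ℤ
open import Data.List using (List; []; _∷_; _++_; map; length; filter; concatMap)
open import Data.List.Properties using (≡-dec; ++-assoc; ++-identityʳ; map-++; length-++; ∷-injectiveˡ; ∷-injectiveʳ; filter-accept; filter-none)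
open import Data.List.Membership.Propositional using () renaming (_∈_ to _∈ₗ_)
open import Data.List.Membership.Propositional.Properties using (∈-map⁺)
open import Data.List.Relation.Unary.Any using (here; there)
open import Data.List.Relation.Unary.All as All using (All; []; _∷_)
import Data.List.Relation.Unary.All.Properties as All
open import Data.List.Relation.Unary.AllPairs as AllPairs using (AllPairs; []; _∷_)
import Data.List.Relation.Unary.AllPairs.Properties as AllPairs
open import Data.Maybe using (Maybe; just; nothing)
open import Data.Nat as ℕ using (ℕ; zero; suc; _∸_; _/_)
import Data.Nat.Properties as ℕ
import Data.Nat.DivMod as ℕ
open import Data.Product using (Σ; _×_; _,_; proj₁; proj₂)
open import Data.Sign as Sign using (Sign)
open import Data.Vec as Vec using ([]; _∷_)
open import Relation.Binary.Bundles using (Setoid)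
open import Relation.Binary.Definitions using (tri<; tri≈; tri>)
import Relation.Binary.Reasoning.Setoid as SetoidReasoning
open import Relation.Binary.PropositionalEquality as P using (_≡_; _≢_; refl)
open import Relation.Nullary using (yes; no; ¬_; contradiction)

-- Coefficient identities in R are discharged by the standard library's ring
-- solver.  It compares normal forms whose coefficients must compute, so it
-- cannot use the elements of an arbitrary R as coefficients (1# + - 1# would
-- not cancel); we use integer coefficients through the canonical map ℤ → R.
module IntegerCoefficients {c ℓ} (R : CommutativeRing c ℓ) where
  open CommutativeRing R renaming (refl to ≈-refl)
  open import Algebra.Properties.Ring ring using (-‿+-comm; -‿involutive; -0#≈0#; -‿distribˡ-*)
  open import Algebra.Properties.Semiring.Mult.TCOptimised semiring using (1+×; ×-homo-+; ×1-homo-*) renaming (_×_ to _×ₙ_)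
  open import Algebra.Properties.CommutativeSemigroup +-commutativeSemigroup using () renaming (interchange to +-interchange)
  open import Algebra.Properties.CommutativeSemigroup *-commutativeSemigroup using () renaming (interchange to *-interchange)
  open import Relation.Binary.Reasoning.Setoid setoid

  ι : ℕ → Carrier
  ι n = n ×ₙ 1#

  ⟦_⟧ : ℤ → Carrier
  ⟦ + n ⟧ = ι n
  ⟦ -[1+ n ] ⟧ = - ι (suc n)

  private
    cancelˡ : ∀ x a b → (x + a) + - (x + b) ≈ a + - b
    cancelˡ x a b = begin
      (x + a) + - (x + b)   ≈⟨ +-congˡ (sym (-‿+-comm x b)) ⟩
      (x + a) + (- x + - b) ≈⟨ +-interchange x a (- x) (- b) ⟩
      (x + - x) + (a + - b) ≈⟨ +-congʳ (-‿inverseʳ x) ⟩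
      0# + (a + - b)        ≈⟨ +-identityˡ _ ⟩
      a + - b               ∎

  ⊖-homo : ∀ m n → ⟦ m ⊖ n ⟧ ≈ ι m + - ι n
  ⊖-homo zero zero = sym (trans (+-identityˡ _) -0#≈0#)
  ⊖-homo (suc m) zero = sym (trans (+-congˡ -0#≈0#) (+-identityʳ _))
  ⊖-homo zero (suc n) = sym (+-identityˡ _)
  ⊖-homo (suc m) (suc n) = begin
    ⟦ suc m ⊖ suc n ⟧ ≡⟨ P.cong ⟦_⟧ (ℤ.[1+m]⊖[1+n]≡m⊖n m n) ⟩
    ⟦ m ⊖ n ⟧         ≈⟨ ⊖-homo m n ⟩
    ι m + - ι n       ≈⟨ sym (cancelˡ 1# (ι m) (ι n)) ⟩
    (1# + ι m) + - (1# + ι n) ≈⟨ sym (+-cong (1+× m 1#) (-‿cong (1+× n 1#))) ⟩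
    ι (suc m) + - ι (suc n) ∎

  +-homo : ∀ i j → ⟦ i ℤ.+ j ⟧ ≈ ⟦ i ⟧ + ⟦ j ⟧
  +-homo -[1+ m ] -[1+ n ] = begin
    - ι (suc (suc (m ℕ.+ n)))     ≈⟨ -‿cong (trans (1+× (suc (m ℕ.+ n)) 1#) (+-congˡ (trans (1+× (m ℕ.+ n) 1#) (+-congˡ (×-homo-+ 1# m n))))) ⟩
    - (1# + (1# + (ι m + ι n)))   ≈⟨ -‿cong (sym (+-assoc 1# 1# _)) ⟩
    - ((1# + 1#) + (ι m + ι n))   ≈⟨ -‿cong (+-interchange 1# 1# (ι m) (ι n)) ⟩
    - ((1# + ι m) + (1# + ι n))   ≈⟨ sym (-‿+-comm _ _) ⟩
    - (1# + ι m) + - (1# + ι n)   ≈⟨ sym (+-cong (-‿cong (1+× m 1#)) (-‿cong (1+× n 1#))) ⟩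
    - ι (suc m) + - ι (suc n)     ∎
  +-homo -[1+ m ] (+ n) = trans (⊖-homo n (suc m)) (+-comm _ _)
  +-homo (+ m) -[1+ n ] = ⊖-homo m (suc n)
  +-homo (+ m) (+ n) = ×-homo-+ 1# m n

  σ : Sign → Carrier
  σ Sign.+ = 1#
  σ Sign.- = - 1#

  σ-homo : ∀ s t → σ (s Sign.* t) ≈ σ s * σ t
  σ-homo Sign.- Sign.- = sym (trans (sym (-‿distribˡ-* _ _)) (trans (-‿cong (*-identityˡ _)) (-‿involutive _)))
  σ-homo Sign.- Sign.+ = sym (*-identityʳ _)
  σ-homo Sign.+ Sign.- = sym (*-identityˡ _)
  σ-homo Sign.+ Sign.+ = sym (*-identityˡ _)

  ◃-homo : ∀ s k → ⟦ s ◃ k ⟧ ≈ σ s * ι k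
  ◃-homo s zero = sym (zeroʳ _)
  ◃-homo Sign.- (suc k) = trans (-‿cong (sym (*-identityˡ _))) (-‿distribˡ-* _ _)
  ◃-homo Sign.+ (suc k) = sym (*-identityˡ _)

  sign-abs : ∀ i → ⟦ i ⟧ ≈ σ (sign i) * ι ∣ i ∣
  sign-abs i = trans (reflexive (P.cong ⟦_⟧ (P.sym (ℤ.◃-inverse i)))) (◃-homo (sign i) ∣ i ∣)

  *-homo : ∀ i j → ⟦ i ℤ.* j ⟧ ≈ ⟦ i ⟧ * ⟦ j ⟧
  *-homo i j = begin
    ⟦ (sign i Sign.* sign j) ◃ (∣ i ∣ ℕ.* ∣ j ∣) ⟧     ≈⟨ ◃-homo (sign i Sign.* sign j) (∣ i ∣ ℕ.* ∣ j ∣) ⟩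
    σ (sign i Sign.* sign j) * ι (∣ i ∣ ℕ.* ∣ j ∣)     ≈⟨ *-cong (σ-homo (sign i) (sign j)) (×1-homo-* ∣ i ∣ ∣ j ∣) ⟩
    (σ (sign i) * σ (sign j)) * (ι ∣ i ∣ * ι ∣ j ∣)    ≈⟨ *-interchange _ _ _ _ ⟩
    (σ (sign i) * ι ∣ i ∣) * (σ (sign j) * ι ∣ j ∣)    ≈⟨ sym (*-cong (sign-abs i) (sign-abs j)) ⟩
    ⟦ i ⟧ * ⟦ j ⟧                                      ∎

  neg-homo : ∀ i → ⟦ ℤ.- i ⟧ ≈ - ⟦ i ⟧
  neg-homo (+ zero) = sym -0#≈0#
  neg-homo (+ suc n) = ≈-refl
  neg-homo -[1+ n ] = sym (-‿involutive _)

  homomorphism : ℤ.+-*-rawRing -Raw-AlmostCommutative⟶ fromCommutativeRing R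
  homomorphism = record
    { ⟦_⟧ = ⟦_⟧ ; +-homo = +-homo ; *-homo = *-homo ; -‿homo = neg-homo
    ; 0-homo = ≈-refl ; 1-homo = ≈-refl }

  coefficient-equality : ∀ i j → Maybe (⟦ i ⟧ ≈ ⟦ j ⟧)
  coefficient-equality i j with i ℤ.≟ j
  ... | yes refl = just ≈-refl
  ... | no _ = nothing

  open import Algebra.Solver.Ring ℤ.+-*-rawRing (fromCommutativeRing R) homomorphism coefficient-equality
    public using (solve; _:=_; _:+_; _:*_; :-_; con)

-- Strictly increasing words: these are exactly the words containing no
-- leading monomial t_r t_r or t_r t_p (p < r) of G_q(∅).
Increasing : ∀ {n} → List (Fin n) → Set
Increasing = AllPairs Fin._<_

elems-increasing : ∀ {n} (J : Subset n) → Increasing (elems J)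
elems-increasing {zero} [] = []
elems-increasing {suc n} (true ∷ J) =
  All.map⁺ (All.universal (λ _ → ℕ.z<s) (elems J)) ∷ AllPairs.map⁺ (AllPairs.map ℕ.s<s (elems-increasing J))
elems-increasing {suc n} (false ∷ J) = AllPairs.map⁺ (AllPairs.map ℕ.s<s (elems-increasing J))

record SplitAt {n} (s : Fin n) : Set where
  constructor split
  field
    below above : List (Fin n)
    below<s : All (Fin._< s) below
    s<above : All (s Fin.<_) above
open SplitAt public

private
  shift : ∀ {n} {s : Fin n} → SplitAt s → SplitAt (suc s)
  shift (split b a b<s s<a) = split (map suc b) (map suc a) (All.map⁺ (All.map ℕ.s<s b<s)) (All.map⁺ (All.map ℕ.s<s s<a))

  addZero : ∀ {n} {s : Fin n} → SplitAt (suc s) → SplitAt (suc s)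
  addZero (split b a b<s s<a) = split (zero ∷ b) a (ℕ.z<s ∷ b<s) s<a

  map-suc-split : ∀ {n} (b a : List (Fin n)) s → map suc (b ++ s ∷ a) ≡ map suc b ++ suc s ∷ map suc a
  map-suc-split b a s = map-++ suc b (s ∷ a)

split-∈ : ∀ {n} (J : Subset n) s → s ∈ J → Σ (SplitAt s) λ sp → elems J ≡ below sp ++ s ∷ above sp
split-∈ {suc n} (true ∷ J) zero Vec.here = split [] (map suc (elems J)) [] (All.map⁺ (All.universal (λ _ → ℕ.z<s) (elems J))) , refl
split-∈ {suc n} (b ∷ J) (suc s) (Vec.there s∈J) with split-∈ J s s∈J | b
... | sp , eq | true = addZero (shift sp) , P.cong (zero ∷_) (P.trans (P.cong (map suc) eq) (map-suc-split (below sp) (above sp) s))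
... | sp , eq | false = shift sp , P.trans (P.cong (map suc) eq) (map-suc-split (below sp) (above sp) s)

split-∉ : ∀ {n} (J : Subset n) s → s ∉ J →
          Σ (SplitAt s) λ sp → elems J ≡ below sp ++ above sp × elems (J ∪ ⁅ s ⁆) ≡ below sp ++ s ∷ above sp
split-∉ {suc n} (true ∷ J) zero s∉J = contradiction Vec.here s∉J
split-∉ {suc n} (false ∷ J) zero s∉J =
  split [] (map suc (elems J)) [] (All.map⁺ (All.universal (λ _ → ℕ.z<s) (elems J))) ,
  refl , P.cong (λ K → zero ∷ map suc (elems K)) (∪-identityʳ J)
split-∉ {suc n} (b ∷ J) (suc s) s∉J with split-∉ J s (λ s∈J → s∉J (Vec.there s∈J)) | b
... | sp , eq , eq∪ | true =
  addZero (shift sp) ,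
  P.cong (zero ∷_) (P.trans (P.cong (map suc) eq) (map-++ suc (below sp) (above sp))) ,
  P.cong (zero ∷_) (P.trans (P.cong (map suc) eq∪) (map-suc-split (below sp) (above sp) s))
... | sp , eq , eq∪ | false =
  shift sp ,
  P.trans (P.cong (map suc) eq) (map-++ suc (below sp) (above sp)) ,
  P.trans (P.cong (map suc) eq∪) (map-suc-split (below sp) (above sp) s)

#below-split : ∀ {n} (J : Subset n) {s} (sp : SplitAt s) → elems J ≡ below sp ++ above sp → #below J s ≡ length (below sp)
#below-split J {s} (split b a b<s s<a) eq = P.cong length (P.trans (P.cong (filter (_<? s)) eq) (keep b b<s))
  where
  keep : ∀ xs → All (Fin._< s) xs → filter (_<? s) (xs ++ a) ≡ xs
  keep [] [] = filter-none (_<? s) (All.map (λ s<y y<s → Fin.<-asym s<y y<s) s<a)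
  keep (x ∷ xs) (x<s ∷ xs<s) = P.trans (filter-accept (_<? s) x<s) (P.cong (x ∷_) (keep xs xs<s))

module Polynomials {c ℓ} (R : CommutativeRing c ℓ) (n : ℕ) where
  open CommutativeRing R renaming (refl to ≈-refl)
  open FreeAlg R n
  open IntegerCoefficients R using (solve; _:=_; _:+_; _:*_; :-_)
  open import Algebra.Properties.Ring ring using (-‿+-comm; -0#≈0#; -‿distribˡ-*; x∙y⁻¹≈ε⇒x≈y)

  δ : Word → Word → Carrier
  δ u v = coeff (mono u) v

  δ-self : ∀ u → δ u u ≈ 1#
  δ-self u with ≡-dec Fin._≟_ u u
  ... | yes _ = +-identityʳ 1#
  ... | no u≢u = ⊥-elim (u≢u refl)

  δ-other : ∀ u v → u ≢ v → δ u v ≈ 0#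
  δ-other u v u≢v with ≡-dec Fin._≟_ u v
  ... | yes u≡v = ⊥-elim (u≢v u≡v)
  ... | no _ = ≈-refl

  coeff-∷ : ∀ a u f v → coeff ((a , u) ∷ f) v ≈ a * δ u v + coeff f v
  coeff-∷ a u f v with ≡-dec Fin._≟_ u v
  ... | yes _ = +-congʳ (sym (trans (*-congˡ (+-identityʳ 1#)) (*-identityʳ a)))
  ... | no _ = sym (trans (+-congʳ (zeroʳ a)) (+-identityˡ _))

  coeff-++ : ∀ f g v → coeff (f ++ g) v ≈ coeff f v + coeff g v
  coeff-++ [] g v = sym (+-identityˡ _)
  coeff-++ ((a , u) ∷ f) g v with ≡-dec Fin._≟_ u v
  ... | yes _ = trans (+-congˡ (coeff-++ f g v)) (sym (+-assoc _ _ _))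
  ... | no _ = coeff-++ f g v

  coeff-· : ∀ a f v → coeff (a · f) v ≈ a * coeff f v
  coeff-· a [] v = sym (zeroʳ a)
  coeff-· a ((b , u) ∷ f) v with ≡-dec Fin._≟_ u v
  ... | yes _ = trans (+-congˡ (coeff-· a f v)) (sym (distribˡ a b _))
  ... | no _ = coeff-· a f v

  coeff-⊖ : ∀ f v → coeff (⊖ f) v ≈ - coeff f v
  coeff-⊖ [] v = sym -0#≈0#
  coeff-⊖ ((b , u) ∷ f) v with ≡-dec Fin._≟_ u v
  ... | yes _ = trans (+-congˡ (coeff-⊖ f v)) (-‿+-comm b _)
  ... | no _ = coeff-⊖ f v

  coeff-absent : ∀ f v → All (λ t → proj₂ t ≢ v) f → coeff f v ≈ 0#
  coeff-absent [] v [] = ≈-refl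
  coeff-absent ((a , u) ∷ f) v (u≢v ∷ f∌v) with ≡-dec Fin._≟_ u v
  ... | yes u≡v = ⊥-elim (u≢v u≡v)
  ... | no _ = coeff-absent f v f∌v

  -- Equality in A (coefficientwise), as a record so that both sides can be inferred.
  infix 4 _≅_
  record _≅_ (f g : Poly) : Set ℓ where
    constructor by-coefficients
    field at : ∀ v → coeff f v ≈ coeff g v
  open _≅_ public

  ≅-refl : ∀ {f} → f ≅ f
  ≅-refl = by-coefficients λ _ → ≈-refl

  ≅-reflexive : ∀ {f g} → f ≡ g → f ≅ g
  ≅-reflexive refl = ≅-refl

  ≅-sym : ∀ {f g} → f ≅ g → g ≅ f
  ≅-sym f≅g = by-coefficients λ v → sym (at f≅g v)

  ≅-trans : ∀ {f g h} → f ≅ g → g ≅ h → f ≅ h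
  ≅-trans f≅g g≅h = by-coefficients λ v → trans (at f≅g v) (at g≅h v)

  ≅-setoid : Setoid c ℓ
  ≅-setoid = record { Carrier = Poly ; _≈_ = _≅_
                    ; isEquivalence = record { refl = ≅-refl ; sym = ≅-sym ; trans = ≅-trans } }

  module ≅-Reasoning = SetoidReasoning ≅-setoid

  ⊕-cong : ∀ {f f' g g'} → f ≅ f' → g ≅ g' → f ⊕ g ≅ f' ⊕ g'
  ⊕-cong {f} {f'} {g} {g'} f≅f' g≅g' = by-coefficients λ v →
    trans (coeff-++ f g v) (trans (+-cong (at f≅f' v) (at g≅g' v)) (sym (coeff-++ f' g' v)))

  ·-congˡ : ∀ a {f g} → f ≅ g → a · f ≅ a · g
  ·-congˡ a {f} {g} f≅g = by-coefficients λ v →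
    trans (coeff-· a f v) (trans (*-congˡ (at f≅g v)) (sym (coeff-· a g v)))

  -- Formal R-linear combinations of elements of A.  An identity between two of
  -- them holds in A as soon as it holds for each coefficient, where it is an
  -- identity in R (discharged by the ring solver).
  infixl 6 _⊞_
  infixr 7 _⊠_
  data LinExpr : Set c where
    `_  : Poly → LinExpr
    _⊞_ : LinExpr → LinExpr → LinExpr
    _⊠_ : Carrier → LinExpr → LinExpr

  ⟦_⟧ : LinExpr → Poly
  ⟦ ` f ⟧ = f
  ⟦ e ⊞ e' ⟧ = ⟦ e ⟧ ⊕ ⟦ e' ⟧
  ⟦ a ⊠ e ⟧ = a · ⟦ e ⟧

  coeffOf : LinExpr → Word → Carrier
  coeffOf (` f) v = coeff f v
  coeffOf (e ⊞ e') v = coeffOf e v + coeffOf e' v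
  coeffOf (a ⊠ e) v = a * coeffOf e v

  coeff-⟦⟧ : ∀ e v → coeff ⟦ e ⟧ v ≈ coeffOf e v
  coeff-⟦⟧ (` f) v = ≈-refl
  coeff-⟦⟧ (e ⊞ e') v = trans (coeff-++ ⟦ e ⟧ ⟦ e' ⟧ v) (+-cong (coeff-⟦⟧ e v) (coeff-⟦⟧ e' v))
  coeff-⟦⟧ (a ⊠ e) v = trans (coeff-· a ⟦ e ⟧ v) (*-congˡ (coeff-⟦⟧ e v))

  compare-coefficients : ∀ e e' → (∀ v → coeffOf e v ≈ coeffOf e' v) → ⟦ e ⟧ ≅ ⟦ e' ⟧
  compare-coefficients e e' eq = by-coefficients λ v → trans (coeff-⟦⟧ e v) (trans (eq v) (sym (coeff-⟦⟧ e' v)))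

  evalWith : (Word → Carrier) → Poly → Carrier
  evalWith φ [] = 0#
  evalWith φ ((b , w) ∷ f) = b * φ w + evalWith φ f

  evalWith-++ : ∀ φ f g → evalWith φ (f ++ g) ≈ evalWith φ f + evalWith φ g
  evalWith-++ φ [] g = sym (+-identityˡ _)
  evalWith-++ φ ((b , w) ∷ f) g = trans (+-congˡ (evalWith-++ φ f g)) (sym (+-assoc _ _ _))

  evalWith-· : ∀ φ a f → evalWith φ (a · f) ≈ a * evalWith φ f
  evalWith-· φ a [] = sym (zeroʳ a)
  evalWith-· φ a ((b , w) ∷ f) = trans (+-cong (*-assoc a b _) (evalWith-· φ a f)) (sym (distribˡ a _ _))

  evalWith-⊖ : ∀ φ f → evalWith φ (⊖ f) ≈ - evalWith φ f
  evalWith-⊖ φ [] = sym -0#≈0#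
  evalWith-⊖ φ ((b , w) ∷ f) = trans (+-cong (sym (-‿distribˡ-* b _)) (evalWith-⊖ φ f)) (-‿+-comm _ _)

  removeWord : Word → Poly → Poly
  removeWord w [] = []
  removeWord w ((b , u) ∷ f) with ≡-dec Fin._≟_ u w
  ... | yes _ = removeWord w f
  ... | no _ = (b , u) ∷ removeWord w f

  removeWord-length : ∀ w f → length (removeWord w f) ℕ.≤ length f
  removeWord-length w [] = ℕ.z≤n
  removeWord-length w ((b , u) ∷ f) with ≡-dec Fin._≟_ u w
  ... | yes _ = ℕ.m≤n⇒m≤1+n (removeWord-length w f)
  ... | no _ = ℕ.s≤s (removeWord-length w f)

  removeWord-head : ∀ b w f → length (removeWord w ((b , w) ∷ f)) ℕ.≤ length f
  removeWord-head b w f with ≡-dec Fin._≟_ w w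
  ... | yes _ = removeWord-length w f
  ... | no w≢w = ⊥-elim (w≢w refl)

  coeff-removeWord-self : ∀ w f → coeff (removeWord w f) w ≈ 0#
  coeff-removeWord-self w [] = ≈-refl
  coeff-removeWord-self w ((b , u) ∷ f) with ≡-dec Fin._≟_ u w
  ... | yes _ = coeff-removeWord-self w f
  ... | no u≢w = trans (coeff-∷ b u _ w)
         (trans (+-cong (trans (*-congˡ (δ-other u w u≢w)) (zeroʳ b)) (coeff-removeWord-self w f)) (+-identityʳ 0#))

  coeff-removeWord-other : ∀ w v f → w ≢ v → coeff (removeWord w f) v ≈ coeff f v
  coeff-removeWord-other w v [] w≢v = ≈-refl
  coeff-removeWord-other w v ((b , u) ∷ f) w≢v with ≡-dec Fin._≟_ u w
  ... | yes refl = trans (coeff-removeWord-other w v f w≢v)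
          (sym (trans (coeff-∷ b u f v) (trans (+-congʳ (trans (*-congˡ (δ-other u v w≢v)) (zeroʳ b))) (+-identityˡ _))))
  ... | no _ = trans (coeff-∷ b u _ v) (trans (+-congˡ (coeff-removeWord-other w v f w≢v)) (sym (coeff-∷ b u f v)))

  evalWith-gather : ∀ φ w f → evalWith φ f ≈ coeff f w * φ w + evalWith φ (removeWord w f)
  evalWith-gather φ w [] = sym (trans (+-congʳ (zeroˡ (φ w))) (+-identityˡ 0#))
  evalWith-gather φ w ((b , u) ∷ f) with ≡-dec Fin._≟_ u w
  ... | yes refl = trans (+-congˡ (evalWith-gather φ w f)) (shuffle b (coeff f w) (φ w) _)
    where
    shuffle : ∀ b c p r → b * p + (c * p + r) ≈ (b + c) * p + r
    shuffle = solve 4 (λ b c p r → b :* p :+ (c :* p :+ r) := (b :+ c) :* p :+ r) ≈-refl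
  ... | no _ = trans (+-congˡ (evalWith-gather φ w f)) (shuffle b (φ u) (coeff f w) (φ w) _)
    where
    shuffle : ∀ b x c p r → b * x + (c * p + r) ≈ c * p + (b * x + r)
    shuffle = solve 5 (λ b x c p r → b :* x :+ (c :* p :+ r) := c :* p :+ (b :* x :+ r)) ≈-refl

  -- A functional vanishes on every representative of 0 in A.  Induction on
  -- the length of the representative (bounded by k): remove the first word.
  evalWith-zero : ∀ k φ f → length f ℕ.≤ k → f ≅ [] → evalWith φ f ≈ 0#
  evalWith-zero k φ [] _ _ = ≈-refl
  evalWith-zero (suc k) φ f@((b , w) ∷ g) (ℕ.s≤s |g|≤k) f≅0 = begin
    evalWith φ f                                    ≈⟨ evalWith-gather φ w f ⟩
    coeff f w * φ w + evalWith φ (removeWord w f)   ≈⟨ +-cong (*-congʳ (at f≅0 w)) rest≈0 ⟩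
    0# * φ w + 0#                                   ≈⟨ trans (+-identityʳ _) (zeroˡ (φ w)) ⟩
    0#                                              ∎
    where
    open import Relation.Binary.Reasoning.Setoid setoid
    rest≅0 : removeWord w f ≅ []
    rest≅0 = by-coefficients λ v → coeff-rest v
      where
      coeff-rest : ∀ v → coeff (removeWord w f) v ≈ 0#
      coeff-rest v with ≡-dec Fin._≟_ w v
      ... | yes refl = coeff-removeWord-self w f
      ... | no w≢v = trans (coeff-removeWord-other w v f w≢v) (at f≅0 v)
    rest≈0 : evalWith φ (removeWord w f) ≈ 0#
    rest≈0 = evalWith-zero k φ (removeWord w f) (ℕ.≤-trans (removeWord-head b w g) |g|≤k) rest≅0

  evalWith-cong : ∀ φ {f g} → f ≅ g → evalWith φ f ≈ evalWith φ g
  evalWith-cong φ {f} {g} f≅g = x∙y⁻¹≈ε⇒x≈y _ _ (begin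
    evalWith φ f + - evalWith φ g   ≈⟨ sym (trans (evalWith-++ φ f (⊖ g)) (+-congˡ (evalWith-⊖ φ g))) ⟩
    evalWith φ (f ⊕ (⊖ g))          ≈⟨ evalWith-zero _ φ (f ⊕ (⊖ g)) ℕ.≤-refl difference≅0 ⟩
    0#                              ∎)
    where
    open import Relation.Binary.Reasoning.Setoid setoid
    difference≅0 : f ⊕ (⊖ g) ≅ []
    difference≅0 = by-coefficients λ v →
      trans (coeff-++ f (⊖ g) v) (trans (+-cong (at f≅g v) (coeff-⊖ g v)) (-‿inverseʳ _))

  extend : (Word → Poly) → Poly → Poly
  extend F [] = []
  extend F ((b , w) ∷ f) = (b · F w) ⊕ extend F f

  coeff-extend : ∀ F f v → coeff (extend F f) v ≈ evalWith (λ w → coeff (F w) v) f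
  coeff-extend F [] v = ≈-refl
  coeff-extend F ((b , w) ∷ f) v = trans (coeff-++ (b · F w) _ v) (+-cong (coeff-· b (F w) v) (coeff-extend F f v))

  extend-cong : ∀ F {f g} → f ≅ g → extend F f ≅ extend F g
  extend-cong F {f} {g} f≅g = by-coefficients λ v →
    trans (coeff-extend F f v) (trans (evalWith-cong _ f≅g) (sym (coeff-extend F g v)))

  extend-⊕ : ∀ F f g → extend F (f ⊕ g) ≅ extend F f ⊕ extend F g
  extend-⊕ F f g = ≅-reflexive (extend-++ f)
    where
    extend-++ : ∀ f → extend F (f ++ g) ≡ extend F f ++ extend F g
    extend-++ [] = refl
    extend-++ ((b , w) ∷ f) = P.trans (P.cong ((b · F w) ++_) (extend-++ f)) (P.sym (++-assoc (b · F w) _ _))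

  extend-· : ∀ F a f → extend F (a · f) ≅ a · extend F f
  extend-· F a f = by-coefficients λ v →
    trans (coeff-extend F (a · f) v) (trans (evalWith-· _ a f) (sym (trans (coeff-· a (extend F f) v) (*-congˡ (coeff-extend F f v)))))

  lmul : Word → Poly → Poly
  lmul u [] = []
  lmul u ((b , w) ∷ f) = (b , u ++ w) ∷ lmul u f

  coeff-lmul : ∀ u f v → coeff (lmul u f) v ≈ evalWith (λ w → δ (u ++ w) v) f
  coeff-lmul u [] v = ≈-refl
  coeff-lmul u ((b , w) ∷ f) v = trans (coeff-∷ b (u ++ w) _ v) (+-congˡ (coeff-lmul u f v))

  lmul-cong : ∀ u {f g} → f ≅ g → lmul u f ≅ lmul u g
  lmul-cong u {f} {g} f≅g = by-coefficients λ v →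
    trans (coeff-lmul u f v) (trans (evalWith-cong _ f≅g) (sym (coeff-lmul u g v)))

  lmul-⊕ : ∀ u f g → lmul u (f ⊕ g) ≡ lmul u f ⊕ lmul u g
  lmul-⊕ u [] g = refl
  lmul-⊕ u ((b , w) ∷ f) g = P.cong (_ ∷_) (lmul-⊕ u f g)

  lmul-· : ∀ u a f → lmul u (a · f) ≡ a · lmul u f
  lmul-· u a [] = refl
  lmul-· u a ((b , w) ∷ f) = P.cong (_ ∷_) (lmul-· u a f)

  ·-distrib-⊕ : ∀ a f g → a · (f ⊕ g) ≡ (a · f) ⊕ (a · g)
  ·-distrib-⊕ a f g = map-++ _ f g

  lmul-lmul : ∀ u u' f → lmul u (lmul u' f) ≡ lmul (u ++ u') f
  lmul-lmul u u' [] = refl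
  lmul-lmul u u' ((b , w) ∷ f) = P.cong₂ (λ x y → (b , x) ∷ y) (P.sym (++-assoc u u' w)) (lmul-lmul u u' f)

  lmul-[] : ∀ f → lmul [] f ≡ f
  lmul-[] [] = refl
  lmul-[] ((b , w) ∷ f) = P.cong (_ ∷_) (lmul-[] f)

  ⊛-lmul : ∀ s f → t s ⊛ f ≡ lmul (s ∷ []) f
  ⊛-lmul s [] = refl
  ⊛-lmul s ((b , w) ∷ f) = P.cong₂ (λ x y → (b , s ∷ x) ∷ y) (++-identityʳ w) (⊛-lmul s f)

  Supported : (Word → Set) → Poly → Set c
  Supported Q f = All (λ t → Q (proj₂ t)) f

  Supported-++ : ∀ {Q} f g → Supported Q f → Supported Q g → Supported Q (f ⊕ g)
  Supported-++ f g = All.++⁺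

  Supported-· : ∀ {Q} a f → Supported Q f → Supported Q (a · f)
  Supported-· a f = All.map⁺

  Supported-lmul : ∀ {Q Q' : Word → Set} u f → (∀ {w} → Q w → Q' (u ++ w)) → Supported Q f → Supported Q' (lmul u f)
  Supported-lmul u [] h [] = []
  Supported-lmul u ((b , w) ∷ f) h (qw ∷ qf) = h qw ∷ Supported-lmul u f h qf

  extend-pointwise : ∀ {F G} → (∀ w → F w ≅ G w) → ∀ f → extend F f ≅ extend G f
  extend-pointwise F≅G [] = ≅-refl
  extend-pointwise F≅G ((b , w) ∷ f) = ⊕-cong (·-congˡ b (F≅G w)) (extend-pointwise F≅G f)

  extend-pointwise-on : ∀ {Q F G} f → Supported Q f → (∀ {w} → Q w → F w ≅ G w) → extend F f ≅ extend G f
  extend-pointwise-on [] [] F≅G = ≅-refl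
  extend-pointwise-on ((b , w) ∷ f) (qw ∷ qf) F≅G = ⊕-cong (·-congˡ b (F≅G qw)) (extend-pointwise-on f qf F≅G)

  extend-lmul : ∀ F u f → extend F (lmul u f) ≡ extend (λ w → F (u ++ w)) f
  extend-lmul F u [] = refl
  extend-lmul F u ((b , w) ∷ f) = P.cong ((b · F (u ++ w)) ⊕_) (extend-lmul F u f)

  extend-mono : ∀ u f → extend (λ w → mono (u ++ w)) f ≅ lmul u f
  extend-mono u [] = ≅-refl
  extend-mono u ((b , w) ∷ f) = by-coefficients λ v →
    trans (coeff-++ (b · mono (u ++ w)) _ v)
    (trans (+-cong (coeff-· b (mono (u ++ w)) v) (at (extend-mono u f) v)) (sym (coeff-∷ b (u ++ w) _ v)))

  extend-scaled : ∀ a F f → extend (λ w → a · F w) f ≅ a · extend F f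
  extend-scaled a F [] = ≅-refl
  extend-scaled a F ((b , w) ∷ f) = ≅-trans (⊕-cong ≅-refl (extend-scaled a F f))
    (compare-coefficients (b ⊠ a ⊠ ` F w ⊞ a ⊠ ` extend F f) (a ⊠ (b ⊠ ` F w ⊞ ` extend F f))
      λ v → solve 4 (λ a b x y → b :* (a :* x) :+ a :* y := a :* (b :* x :+ y)) ≈-refl a b _ _)

  extend-sum : ∀ F G f → extend (λ w → F w ⊕ G w) f ≅ extend F f ⊕ extend G f
  extend-sum F G [] = ≅-refl
  extend-sum F G ((b , w) ∷ f) = ≅-trans (⊕-cong ≅-refl (extend-sum F G f))
    (compare-coefficients (b ⊠ (` F w ⊞ ` G w) ⊞ (` extend F f ⊞ ` extend G f)) ((b ⊠ ` F w ⊞ ` extend F f) ⊞ (b ⊠ ` G w ⊞ ` extend G f))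
      λ v → solve 5 (λ b x y x' y' → b :* (x :+ y) :+ (x' :+ y') := (b :* x :+ x') :+ (b :* y :+ y')) ≈-refl b _ _ _ _)

  extend-lmul-outer : ∀ u F f → extend (λ w → lmul u (F w)) f ≅ lmul u (extend F f)
  extend-lmul-outer u F [] = ≅-refl
  extend-lmul-outer u F ((b , w) ∷ f) = ≅-trans (⊕-cong ≅-refl (extend-lmul-outer u F f))
    (≅-reflexive (P.sym (P.trans (lmul-⊕ u (b · F w) (extend F f)) (P.cong (_⊕ lmul u (extend F f)) (lmul-· u b (F w))))))

module Reductions {c ℓ} (R : CommutativeRing c ℓ) (n : ℕ) (q : CommutativeRing.Carrier R) where
  open CommutativeRing R renaming (refl to ≈-refl)
  open FreeAlg R n
  open Polynomials R n
  open IntegerCoefficients R using (solve; _:=_; _:+_; _:*_; :-_; con)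

  -- A reduction site: a generator g together with the context u _ v of its
  -- leading monomial.  Reducing at it subtracts c · u g v, c being the
  -- coefficient of u (lm g) v.
  Site : Set
  Site = Gen × Word × Word

  siteWord : Site → Word
  siteWord (g , u , v) = u ++ lm g ++ v

  sitePoly : Site → Poly
  sitePoly (g , u , v) = sandwich u (gpoly q g) v

  reduceAt : Site → Poly → Poly
  reduceAt x f = f ⊕ (⊖ (coeff f (siteWord x) · sitePoly x))

  reduceAlong : List Site → Poly → Poly
  reduceAlong [] f = f
  reduceAlong (x ∷ xs) f = reduceAlong xs (reduceAt x f)

  reduces-along : ∀ xs f {h} → reduceAlong xs f ≅ h → Reduces q f h
  reduces-along [] f end = done (at end)
  reduces-along ((g , u , v) ∷ xs) f end = step (g , u , v , λ _ → ≈-refl) (reduces-along xs _ end)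

  coeff-reduceAt : ∀ x f w → coeff (reduceAt x f) w ≈ coeff f w + - (coeff f (siteWord x) * coeff (sitePoly x) w)
  coeff-reduceAt x f w = trans (coeff-++ f _ w)
    (+-congˡ (trans (coeff-⊖ (coeff f (siteWord x) · sitePoly x) w) (-‿cong (coeff-· (coeff f (siteWord x)) (sitePoly x) w))))

  reduceAt-cong : ∀ x {f g} → f ≅ g → reduceAt x f ≅ reduceAt x g
  reduceAt-cong x {f} {g} f≅g = by-coefficients λ w → trans (coeff-reduceAt x f w)
    (trans (+-cong (at f≅g w) (-‿cong (*-congʳ (at f≅g (siteWord x))))) (sym (coeff-reduceAt x g w)))

  reduceAt-⊕ : ∀ x f g → reduceAt x (f ⊕ g) ≅ reduceAt x f ⊕ reduceAt x g
  reduceAt-⊕ x f g = by-coefficients λ w → trans (coeff-reduceAt x (f ⊕ g) w)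
    (trans (+-cong (coeff-++ f g w) (-‿cong (*-congʳ (coeff-++ f g (siteWord x)))))
    (trans (linear (coeff f w) (coeff g w) (coeff f (siteWord x)) (coeff g (siteWord x)) (coeff (sitePoly x) w))
    (sym (trans (coeff-++ (reduceAt x f) (reduceAt x g) w) (+-cong (coeff-reduceAt x f w) (coeff-reduceAt x g w))))))
    where
    linear : ∀ a b a' b' p → (a + b) + - ((a' + b') * p) ≈ (a + - (a' * p)) + (b + - (b' * p))
    linear = solve 5 (λ a b a' b' p → (a :+ b) :+ :- ((a' :+ b') :* p) := (a :+ :- (a' :* p)) :+ (b :+ :- (b' :* p))) ≈-refl

  reduceAt-· : ∀ x a f → reduceAt x (a · f) ≅ a · reduceAt x f
  reduceAt-· x a f = by-coefficients λ w → trans (coeff-reduceAt x (a · f) w)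
    (trans (+-cong (coeff-· a f w) (-‿cong (*-congʳ (coeff-· a f (siteWord x)))))
    (trans (linear a (coeff f w) (coeff f (siteWord x)) (coeff (sitePoly x) w))
    (sym (trans (coeff-· a (reduceAt x f) w) (*-congˡ (coeff-reduceAt x f w))))))
    where
    linear : ∀ a b b' p → a * b + - ((a * b') * p) ≈ a * (b + - (b' * p))
    linear = solve 4 (λ a b b' p → a :* b :+ :- ((a :* b') :* p) := a :* (b :+ :- (b' :* p))) ≈-refl

  reduceAt-idle : ∀ x f → coeff f (siteWord x) ≈ 0# → reduceAt x f ≅ f
  reduceAt-idle x f c≈0 = by-coefficients λ w → trans (coeff-reduceAt x f w)
    (trans (+-congˡ (-‿cong (*-congʳ c≈0))) (vanish (coeff f w) (coeff (sitePoly x) w)))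
    where
    vanish : ∀ a p → a + - (0# * p) ≈ a
    vanish = solve 2 (λ a p → a :+ :- (con (ℤ.+ 0) :* p) := a) ≈-refl

  reduceAlong-cong : ∀ xs {f g} → f ≅ g → reduceAlong xs f ≅ reduceAlong xs g
  reduceAlong-cong [] f≅g = f≅g
  reduceAlong-cong (x ∷ xs) f≅g = reduceAlong-cong xs (reduceAt-cong x f≅g)

  reduceAlong-⊕ : ∀ xs f g → reduceAlong xs (f ⊕ g) ≅ reduceAlong xs f ⊕ reduceAlong xs g
  reduceAlong-⊕ [] f g = ≅-refl
  reduceAlong-⊕ (x ∷ xs) f g = ≅-trans (reduceAlong-cong xs (reduceAt-⊕ x f g)) (reduceAlong-⊕ xs _ _)

  reduceAlong-· : ∀ xs a f → reduceAlong xs (a · f) ≅ a · reduceAlong xs f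
  reduceAlong-· [] a f = ≅-refl
  reduceAlong-· (x ∷ xs) a f = ≅-trans (reduceAlong-cong xs (reduceAt-· x a f)) (reduceAlong-· xs a _)

  reduceAlong-idle : ∀ xs f → All (λ x → coeff f (siteWord x) ≈ 0#) xs → reduceAlong xs f ≅ f
  reduceAlong-idle [] f [] = ≅-refl
  reduceAlong-idle (x ∷ xs) f (c≈0 ∷ cs≈0) = ≅-trans (reduceAlong-cong xs (reduceAt-idle x f c≈0)) (reduceAlong-idle xs f cs≈0)

  reduceAlong-++ : ∀ xs ys f → reduceAlong (xs ++ ys) f ≡ reduceAlong ys (reduceAlong xs f)
  reduceAlong-++ [] ys f = refl
  reduceAlong-++ (x ∷ xs) ys f = reduceAlong-++ xs ys (reduceAt x f)

  site-not-increasing : ∀ x → ¬ Increasing (siteWord x)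
  site-not-increasing (sq r , [] , v) ((r<r ∷ _) ∷ _) = Fin.<-irrefl refl r<r
  site-not-increasing (anti p r p<r , [] , v) ((r<p ∷ _) ∷ _) = Fin.<-asym p<r r<p
  site-not-increasing (g , a ∷ u , v) (_ ∷ inc) = site-not-increasing (g , u , v) inc

  reduceAlong-increasing : ∀ xs f → Supported Increasing f → reduceAlong xs f ≅ f
  reduceAlong-increasing xs f inc = reduceAlong-idle xs f (All.universal absent xs)
    where
    absent : ∀ x → coeff f (siteWord x) ≈ 0#
    absent x = coeff-absent f (siteWord x) (All.map (λ {t} inc-t eq → site-not-increasing x (P.subst Increasing eq inc-t)) inc)

module NormalForm {c ℓ} (R : CommutativeRing c ℓ) (n : ℕ) (q : CommutativeRing.Carrier R) (s : Fin n) where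
  open CommutativeRing R renaming (refl to ≈-refl)
  open FreeAlg R n
  open Polynomials R n
  open Reductions R n q
  open IntegerCoefficients R using (solve; _:=_; _:+_; _:*_; :-_; con)

  -- The normal form of t_s t_w for an increasing word w: t_s moves to the
  -- right past every smaller letter x (t_s t_x → -t_x t_s + 2q), and
  -- t_s t_s → q, until it meets a larger letter or the end.
  nf : Word → Poly
  nf [] = mono (s ∷ [])
  nf (x ∷ w) with Fin.<-cmp s x
  ... | tri< _ _ _ = mono (s ∷ x ∷ w)
  ... | tri≈ _ _ _ = q · mono w
  ... | tri> _ _ _ = ((- 1#) · lmul (x ∷ []) (nf w)) ⊕ ((q + q) · mono w)

  chain : Word → Word → List Site
  chain u [] = []
  chain u (x ∷ w) with Fin.<-cmp s x
  ... | tri< _ _ _ = []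
  ... | tri≈ _ _ _ = (sq s , u , w) ∷ []
  ... | tri> _ _ x<s = (anti x s x<s , u , w) ∷ chain (u ++ x ∷ []) w

  chain-length : ∀ u w → All (λ y → length (siteWord y) ≡ length (u ++ s ∷ w)) (chain u w)
  chain-length u [] = []
  chain-length u (x ∷ w) with Fin.<-cmp s x
  ... | tri< _ _ _ = []
  ... | tri≈ _ refl _ = refl ∷ []
  ... | tri> _ _ _ = refl ∷ All.map (λ eq → P.trans eq swapped) (chain-length (u ++ x ∷ []) w)
    where
    swapped : length ((u ++ x ∷ []) ++ s ∷ w) ≡ length (u ++ s ∷ x ∷ w)
    swapped = P.trans (P.cong length (++-assoc u (x ∷ []) (s ∷ w))) (P.trans (length-++ u) (P.sym (length-++ u)))

  chain-head : ∀ a u w → All (λ y → Σ Word λ v → siteWord y ≡ a ∷ v) (chain (a ∷ u) w)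
  chain-head a u [] = []
  chain-head a u (x ∷ w) with Fin.<-cmp s x
  ... | tri< _ _ _ = []
  ... | tri≈ _ _ _ = (_ , refl) ∷ []
  ... | tri> _ _ _ = (_ , refl) ∷ chain-head a (u ++ x ∷ []) w

  reduceAt-own : ∀ x v → coeff (reduceAt x (mono (siteWord x))) v ≈ δ (siteWord x) v + - (1# * coeff (sitePoly x) v)
  reduceAt-own x v = trans (coeff-reduceAt x (mono (siteWord x)) v) (+-congˡ (-‿cong (*-congʳ (δ-self (siteWord x)))))

  reduce-square : ∀ u w → reduceAt (sq s , u , w) (mono (u ++ s ∷ s ∷ w)) ≅ q · mono (u ++ w)
  reduce-square u w = by-coefficients λ v → trans (reduceAt-own (sq s , u , w) v)
    (trans (+-congˡ (-‿cong (*-congˡ (trans (coeff-∷ 1# W _ v) (+-congˡ (coeff-∷ (- q) U [] v))))))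
    (trans (identity (δ W v) (δ U v) q) (sym (coeff-· q (mono U) v))))
    where
    W U : Word
    W = u ++ s ∷ s ∷ w
    U = u ++ w
    identity : ∀ a b q → a + - (1# * (1# * a + (- q * b + 0#))) ≈ q * b
    identity = solve 3 (λ a b q → a :+ :- (con (ℤ.+ 1) :* (con (ℤ.+ 1) :* a :+ (:- q :* b :+ con (ℤ.+ 0))))
                                := q :* b) ≈-refl

  reduce-swap : ∀ {x} (x<s : x Fin.< s) u w →
    reduceAt (anti x s x<s , u , w) (mono (u ++ s ∷ x ∷ w)) ≅ ((- 1#) · mono (u ++ x ∷ s ∷ w)) ⊕ ((q + q) · mono (u ++ w))
  reduce-swap {x} x<s u w = by-coefficients λ v → trans (reduceAt-own (anti x s x<s , u , w) v)
    (trans (+-congˡ (-‿cong (*-congˡ (trans (coeff-∷ 1# W _ v) (+-congˡ (trans (coeff-∷ 1# X _ v) (+-congˡ (coeff-∷ (- (q + q)) U [] v))))))))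
    (trans (identity (δ W v) (δ X v) (δ U v) q)
    (sym (coeff-⟦⟧ (((- 1#) ⊠ ` mono X) ⊞ ((q + q) ⊠ ` mono U)) v))))
    where
    W X U : Word
    W = u ++ s ∷ x ∷ w
    X = u ++ x ∷ s ∷ w
    U = u ++ w
    identity : ∀ a b d q → a + - (1# * (1# * a + (1# * b + (- (q + q) * d + 0#)))) ≈ - 1# * b + (q + q) * d
    identity = solve 4 (λ a b d q → a :+ :- (con (ℤ.+ 1) :* (con (ℤ.+ 1) :* a :+ (con (ℤ.+ 1) :* b :+ (:- (q :+ q) :* d :+ con (ℤ.+ 0)))))
                                  := :- con (ℤ.+ 1) :* b :+ (q :+ q) :* d) ≈-refl

  private
    n≢2+n : ∀ (k : ℕ) → k ≢ suc (suc k)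
    n≢2+n zero ()
    n≢2+n (suc k) eq = n≢2+n k (ℕ.suc-injective eq)

    shorter : ∀ (u : Word) (a b : Fin n) w → length (u ++ w) ≢ length (u ++ a ∷ b ∷ w)
    shorter u a b w eq = n≢2+n (length w)
      (ℕ.+-cancelˡ-≡ (length u) _ _ (P.trans (P.sym (length-++ u)) (P.trans eq (length-++ u))))

  chain-sound : ∀ u w → reduceAlong (chain u w) (mono (u ++ s ∷ w)) ≅ lmul u (nf w)
  chain-sound u [] = ≅-refl
  chain-sound u (x ∷ w) with Fin.<-cmp s x
  ... | tri< _ _ _ = ≅-refl
  ... | tri≈ _ refl _ = ≅-trans (reduce-square u w) (≅-reflexive (P.sym (lmul-· u q (mono w))))
  ... | tri> _ _ x<s = begin
    reduceAlong rest (reduceAt (anti x s x<s , u , w) (mono (u ++ s ∷ x ∷ w)))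
      ≈⟨ reduceAlong-cong rest (reduce-swap x<s u w) ⟩
    reduceAlong rest (((- 1#) · mono (u ++ x ∷ s ∷ w)) ⊕ ((q + q) · mono (u ++ w)))
      ≡⟨ P.cong (λ X → reduceAlong rest (((- 1#) · mono X) ⊕ ((q + q) · mono (u ++ w)))) (P.sym (++-assoc u (x ∷ []) (s ∷ w))) ⟩
    reduceAlong rest (((- 1#) · mono ((u ++ x ∷ []) ++ s ∷ w)) ⊕ ((q + q) · mono (u ++ w)))
      ≈⟨ ≅-trans (reduceAlong-⊕ rest _ _) (⊕-cong (reduceAlong-· rest (- 1#) _) (reduceAlong-· rest (q + q) _)) ⟩
    ((- 1#) · reduceAlong rest (mono ((u ++ x ∷ []) ++ s ∷ w))) ⊕ ((q + q) · reduceAlong rest (mono (u ++ w)))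
      ≈⟨ ⊕-cong (·-congˡ (- 1#) (chain-sound (u ++ x ∷ []) w)) (·-congˡ (q + q) (reduceAlong-idle rest (mono (u ++ w)) untouched)) ⟩
    ((- 1#) · lmul (u ++ x ∷ []) (nf w)) ⊕ ((q + q) · mono (u ++ w))
      ≡⟨ P.sym (P.trans (lmul-⊕ u ((- 1#) · lmul (x ∷ []) (nf w)) ((q + q) · mono w)) (P.cong₂ _⊕_ (P.trans (lmul-· u (- 1#) _) (P.cong ((- 1#) ·_) (lmul-lmul u (x ∷ []) (nf w))))
                                                    (lmul-· u (q + q) (mono w)))) ⟩
    lmul u (((- 1#) · lmul (x ∷ []) (nf w)) ⊕ ((q + q) · mono w)) ∎
    where
    open ≅-Reasoning
    rest : List Site
    rest = chain (u ++ x ∷ []) w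
    -- the later sites are too long to meet u ++ w
    untouched : All (λ y → coeff (mono (u ++ w)) (siteWord y) ≈ 0#) rest
    untouched = All.map (λ {y} len → δ-other (u ++ w) (siteWord y) λ eq →
                  shorter u x s w (P.trans (P.cong length eq) (P.trans len (P.cong length (++-assoc u (x ∷ []) (s ∷ w))))))
                (chain-length (u ++ x ∷ []) w)

  chain-other : ∀ w' w → w' ≢ w → reduceAlong (chain [] w') (mono (s ∷ w)) ≅ mono (s ∷ w)
  chain-other w' w w'≢w = reduceAlong-idle (chain [] w') (mono (s ∷ w)) (avoid w' w'≢w)
    where
    avoid : ∀ w' → w' ≢ w → All (λ y → coeff (mono (s ∷ w)) (siteWord y) ≈ 0#) (chain [] w')
    avoid [] _ = []
    avoid (x ∷ w') w'≢w with Fin.<-cmp s x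
    ... | tri< _ _ _ = []
    ... | tri≈ _ refl _ = δ-other (s ∷ w) _ (λ eq → w'≢w (P.sym (∷-injectiveʳ eq))) ∷ []
    ... | tri> _ _ x<s = δ-other (s ∷ w) _ (λ eq → w'≢w (P.sym (∷-injectiveʳ eq)))
        ∷ All.map (λ { {y} (v , eq) → δ-other (s ∷ w) (siteWord y) λ eq' → Fin.<-irrefl (P.sym (∷-injectiveˡ (P.trans eq' eq))) x<s })
                  (chain-head x [] w')

  nf-letters : ∀ (P : Fin n → Set) w → P s → All P w → Supported (All P) (nf w)
  nf-letters P [] ps [] = (ps ∷ []) ∷ []
  nf-letters P (x ∷ w) ps (px ∷ pw) with Fin.<-cmp s x
  ... | tri< _ _ _ = (ps ∷ px ∷ pw) ∷ []
  ... | tri≈ _ _ _ = (pw ∷ [])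
  ... | tri> _ _ _ = Supported-++ _ _ (Supported-· (- 1#) _ (Supported-lmul (x ∷ []) (nf w) (px ∷_) (nf-letters P w ps pw)))
                                      ((pw ∷ []))

  nf-increasing : ∀ w → Increasing w → Supported Increasing (nf w)
  nf-increasing [] [] = ([] ∷ []) ∷ []
  nf-increasing (x ∷ w) (x<w ∷ inc) with Fin.<-cmp s x
  ... | tri< s<x _ _ = ((s<x ∷ All.map (Fin.<-trans s<x) x<w) ∷ x<w ∷ inc) ∷ []
  ... | tri≈ _ _ _ = inc ∷ []
  ... | tri> _ _ x<s = Supported-++ _ _
          (Supported-· (- 1#) _ (Supported-lmul (x ∷ []) (nf w) (λ { (x<w' , inc') → x<w' ∷ inc' })
             (All.zipWith (λ p → p) (nf-letters (x Fin.<_) w x<s x<w , nf-increasing w inc))))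
          (inc ∷ [])

  sitesFor : List Word → List Site
  sitesFor = concatMap (chain [])

  -- For w ∈ ws increasing, reducing along sitesFor ws takes t_s w to nf w:
  -- the chains of other words do not touch t_s w, its own chain produces
  -- nf w, and nf w is irreducible.
  reduce-monomial : ∀ ws w → w ∈ₗ ws → Increasing w → reduceAlong (sitesFor ws) (mono (s ∷ w)) ≅ nf w
  reduce-monomial (w' ∷ ws) w w∈ inc with ≡-dec Fin._≟_ w' w
  ... | yes refl = begin
    reduceAlong (sitesFor (w ∷ ws)) (mono (s ∷ w))                      ≡⟨ reduceAlong-++ (chain [] w) (sitesFor ws) _ ⟩
    reduceAlong (sitesFor ws) (reduceAlong (chain [] w) (mono (s ∷ w)))  ≈⟨ reduceAlong-cong (sitesFor ws) (chain-sound [] w) ⟩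
    reduceAlong (sitesFor ws) (lmul [] (nf w))                           ≡⟨ P.cong (reduceAlong (sitesFor ws)) (lmul-[] (nf w)) ⟩
    reduceAlong (sitesFor ws) (nf w)                                     ≈⟨ reduceAlong-increasing (sitesFor ws) (nf w) (nf-increasing w inc) ⟩
    nf w                                                                 ∎
    where open ≅-Reasoning
  ... | no w'≢w = begin
    reduceAlong (sitesFor (w' ∷ ws)) (mono (s ∷ w))                      ≡⟨ reduceAlong-++ (chain [] w') (sitesFor ws) _ ⟩
    reduceAlong (sitesFor ws) (reduceAlong (chain [] w') (mono (s ∷ w))) ≈⟨ reduceAlong-cong (sitesFor ws) (chain-other w' w w'≢w) ⟩
    reduceAlong (sitesFor ws) (mono (s ∷ w))                             ≈⟨ reduce-monomial ws w (later w∈) inc ⟩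
    nf w                                                                 ∎
    where
    open ≅-Reasoning
    later : w ∈ₗ w' ∷ ws → w ∈ₗ ws
    later (here w≡w') = ⊥-elim (w'≢w (P.sym w≡w'))
    later (there w∈ws) = w∈ws

  NF : Poly → Poly
  NF = extend nf

  reduce-lmul : ∀ ws f → All (λ t → proj₂ t ∈ₗ ws) f → Supported Increasing f →
                reduceAlong (sitesFor ws) (lmul (s ∷ []) f) ≅ NF f
  reduce-lmul ws [] [] [] = reduceAlong-idle (sitesFor ws) [] (All.universal (λ _ → ≈-refl) (sitesFor ws))
  reduce-lmul ws ((b , w) ∷ f) (w∈ ∷ f⊆) (inc ∷ incs) = begin
    reduceAlong xs ((b , s ∷ w) ∷ lmul (s ∷ []) f)                           ≈⟨ reduceAlong-cong xs split-head ⟩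
    reduceAlong xs ((b · mono (s ∷ w)) ⊕ lmul (s ∷ []) f)                    ≈⟨ reduceAlong-⊕ xs _ _ ⟩
    reduceAlong xs (b · mono (s ∷ w)) ⊕ reduceAlong xs (lmul (s ∷ []) f)     ≈⟨ ⊕-cong (reduceAlong-· xs b _) (reduce-lmul ws f f⊆ incs) ⟩
    (b · reduceAlong xs (mono (s ∷ w))) ⊕ NF f                               ≈⟨ ⊕-cong (·-congˡ b (reduce-monomial ws w w∈ inc)) ≅-refl ⟩
    (b · nf w) ⊕ NF f                                                        ∎
    where
    open ≅-Reasoning
    xs : List Site
    xs = sitesFor ws
    split-head : (b , s ∷ w) ∷ lmul (s ∷ []) f ≅ (b · mono (s ∷ w)) ⊕ lmul (s ∷ []) f
    split-head = by-coefficients λ v → trans (coeff-∷ b (s ∷ w) _ v)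
      (sym (trans (coeff-++ (b · mono (s ∷ w)) _ v) (+-congʳ (coeff-· b (mono (s ∷ w)) v))))

  reduces-to-NF : ∀ f {h} → Supported Increasing f → NF f ≅ h → Reduces q (t s ⊛ f) h
  reduces-to-NF f inc NFf≅h = reduces-along (sitesFor words) (t s ⊛ f) (begin
    reduceAlong (sitesFor words) (t s ⊛ f)             ≡⟨ P.cong (reduceAlong (sitesFor words)) (⊛-lmul s f) ⟩
    reduceAlong (sitesFor words) (lmul (s ∷ []) f)     ≈⟨ reduce-lmul words f (All.tabulate (∈-map⁺ proj₂)) inc ⟩
    NF f                                               ≈⟨ NFf≅h ⟩
    _                                                  ∎)
    where
    open ≅-Reasoning
    words : List Word
    words = map proj₂ f

  NF-lmul-below : ∀ {x} → x Fin.< s → ∀ f → NF (lmul (x ∷ []) f) ≅ ((- 1#) · lmul (x ∷ []) (NF f)) ⊕ ((q + q) · f)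
  NF-lmul-below {x} x<s f = begin
    NF (lmul (x ∷ []) f)                                                          ≡⟨ extend-lmul nf (x ∷ []) f ⟩
    extend (λ w → nf (x ∷ w)) f                                                   ≈⟨ extend-pointwise (λ w → ≅-reflexive (nf-below w)) f ⟩
    extend (λ w → ((- 1#) · lmul (x ∷ []) (nf w)) ⊕ ((q + q) · mono w)) f         ≈⟨ extend-sum _ _ f ⟩
    extend (λ w → (- 1#) · lmul (x ∷ []) (nf w)) f ⊕ extend (λ w → (q + q) · mono w) f
      ≈⟨ ⊕-cong (extend-scaled (- 1#) _ f) (extend-scaled (q + q) mono f) ⟩
    ((- 1#) · extend (λ w → lmul (x ∷ []) (nf w)) f) ⊕ ((q + q) · extend mono f)
      ≈⟨ ⊕-cong (·-congˡ (- 1#) (extend-lmul-outer (x ∷ []) nf f)) (·-congˡ (q + q) (≅-trans (extend-mono [] f) (≅-reflexive (lmul-[] f)))) ⟩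
    ((- 1#) · lmul (x ∷ []) (NF f)) ⊕ ((q + q) · f)                               ∎
    where
    open ≅-Reasoning
    nf-below : ∀ w → nf (x ∷ w) ≡ ((- 1#) · lmul (x ∷ []) (nf w)) ⊕ ((q + q) · mono w)
    nf-below w with Fin.<-cmp s x
    ... | tri< s<x _ _ = ⊥-elim (Fin.<-asym s<x x<s)
    ... | tri≈ _ s≡x _ = ⊥-elim (Fin.<-irrefl (P.sym s≡x) x<s)
    ... | tri> _ _ _ = refl

  NF-lmul-self : ∀ f → NF (lmul (s ∷ []) f) ≅ q · f
  NF-lmul-self f = begin
    NF (lmul (s ∷ []) f)          ≡⟨ extend-lmul nf (s ∷ []) f ⟩
    extend (λ w → nf (s ∷ w)) f   ≈⟨ extend-pointwise (λ w → ≅-reflexive (nf-self w)) f ⟩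
    extend (λ w → q · mono w) f   ≈⟨ extend-scaled q mono f ⟩
    q · extend mono f             ≈⟨ ·-congˡ q (≅-trans (extend-mono [] f) (≅-reflexive (lmul-[] f))) ⟩
    q · f                         ∎
    where
    open ≅-Reasoning
    nf-self : ∀ w → nf (s ∷ w) ≡ q · mono w
    nf-self w with Fin.<-cmp s s
    ... | tri< s<s _ _ = ⊥-elim (Fin.<-irrefl refl s<s)
    ... | tri≈ _ _ _ = refl
    ... | tri> _ _ s<s = ⊥-elim (Fin.<-irrefl refl s<s)

  NF-all-above : ∀ f → Supported (All (s Fin.<_)) f → NF f ≅ lmul (s ∷ []) f
  NF-all-above f above = ≅-trans (extend-pointwise-on f above (λ {w} s<w → ≅-reflexive (nf-above w s<w))) (extend-mono (s ∷ []) f)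
    where
    nf-above : ∀ w → All (s Fin.<_) w → nf w ≡ mono (s ∷ w)
    nf-above [] [] = refl
    nf-above (x ∷ w) (s<x ∷ _) with Fin.<-cmp s x
    ... | tri< _ _ _ = refl
    ... | tri≈ _ s≡x _ = ⊥-elim (Fin.<-irrefl s≡x s<x)
    ... | tri> _ _ x<s = ⊥-elim (Fin.<-asym s<x x<s)

-- Combinatorics of ℓ_J(I) under adding a first element to J: if that element
-- is chosen, nothing changes; if not, every chosen position moves by one.
private
  ellAux-shift : ∀ ν i bs → ellAux (suc ν) (positions (suc i) bs) ≡ ellAux ν (positions i bs)
  ellAux-shift ν i [] = refl
  ellAux-shift ν i (true ∷ bs) = P.cong ((i ∸ ν) ℕ.+_) (ellAux-shift (suc ν) (suc i) bs)
  ellAux-shift ν i (false ∷ bs) = ellAux-shift ν (suc i) bs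

  ellAux-step : ∀ ν i bs → ν ℕ.≤ i → ellAux ν (positions (suc i) bs) ≡ count bs ℕ.+ ellAux ν (positions i bs)
  ellAux-step ν i [] ν≤i = refl
  ellAux-step ν i (false ∷ bs) ν≤i = ellAux-step ν (suc i) bs (ℕ.m≤n⇒m≤1+n ν≤i)
  ellAux-step ν i (true ∷ bs) ν≤i = begin
    (suc i ∸ ν) ℕ.+ ellAux (suc ν) (positions (suc (suc i)) bs)
      ≡⟨ P.cong₂ ℕ._+_ (ℕ.+-∸-assoc 1 ν≤i) (ellAux-step (suc ν) (suc i) bs (ℕ.s≤s ν≤i)) ⟩
    suc ((i ∸ ν) ℕ.+ (count bs ℕ.+ rest))   ≡⟨ P.cong suc (x∙yz≈y∙xz (i ∸ ν) (count bs) rest) ⟩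
    suc (count bs ℕ.+ ((i ∸ ν) ℕ.+ rest))   ∎
    where
    open P.≡-Reasoning
    open import Algebra.Properties.CommutativeSemigroup ℕ.+-commutativeSemigroup using (x∙yz≈y∙xz)
    rest : ℕ
    rest = ellAux (suc ν) (positions (suc i) bs)

ell-chosen : ∀ bs → ell (true ∷ bs) ≡ ell bs
ell-chosen bs = ellAux-shift 1 1 bs

ell-skipped : ∀ bs → ell (false ∷ bs) ≡ count bs ℕ.+ ell bs
ell-skipped bs = ellAux-step 1 1 bs (ℕ.s≤s ℕ.z≤n)

half-odd : ∀ c → odd c ≡ true → suc c / 2 ≡ suc ((c ∸ 1) / 2)
half-odd (suc c) _ = ℕ.m/n≡1+[m∸n]/n {suc (suc c)} {2} (ℕ.s≤s (ℕ.s≤s ℕ.z≤n))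

module SignedSums {c ℓ} (R : CommutativeRing c ℓ) (n : ℕ) (q : CommutativeRing.Carrier R) where
  open CommutativeRing R renaming (refl to ≈-refl)
  open FreeAlg R n
  open Polynomials R n
  open IntegerCoefficients R using (solve; _:=_; _:+_; _:*_; :-_; con)

  plusTerm minusTerm : Word → List Bool → Poly
  plusTerm K bs = if odd (count bs) then []
                  else ((sgn (ell bs) * pow (- q) (count bs / 2)) , complementWord K bs) ∷ []
  minusTerm K bs = if odd (count bs) then ((sgn (ell bs) * pow (- q) ((count bs ∸ 1) / 2)) , complementWord K bs) ∷ []
                   else []

  tPlusW tMinusW : Word → Poly
  tPlusW K = concatMap (plusTerm K) (choices (length K))
  tMinusW K = concatMap (minusTerm K) (choices (length K))

  pow-+ : ∀ x a b → pow x (a ℕ.+ b) ≈ pow x a * pow x b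
  pow-+ x zero b = sym (*-identityˡ _)
  pow-+ x (suc a) b = trans (*-congˡ (pow-+ x a b)) (sym (*-assoc _ _ _))

  sgn-parity : ∀ k → sgn k ≈ (if odd k then - 1# else 1#)
  sgn-parity zero = ≈-refl
  sgn-parity (suc k) with odd k | sgn-parity k
  ... | true | sgn≈-1 = trans (*-congˡ sgn≈-1) (solve 0 (:- con (ℤ.+ 1) :* :- con (ℤ.+ 1) := con (ℤ.+ 1)) ≈-refl)
  ... | false | sgn≈1 = trans (*-congˡ sgn≈1) (*-identityʳ _)

  sgn-shift : ∀ k e → sgn (k ℕ.+ e) ≈ (if odd k then - 1# else 1#) * sgn e
  sgn-shift k e = trans (pow-+ (- 1#) k e) (*-congʳ (sgn-parity k))

  single-cong : ∀ {a b} w → a ≈ b → (a , w) ∷ [] ≅ (b , w) ∷ []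
  single-cong {a} {b} w a≈b = by-coefficients λ v →
    trans (coeff-∷ a w [] v) (trans (+-congʳ (*-congʳ a≈b)) (sym (coeff-∷ b w [] v)))

  module NewFirstLetter (j : Fin n) (K : Word) where
    plus-skipped : ∀ bs → plusTerm (j ∷ K) (false ∷ bs) ≅ lmul (j ∷ []) (plusTerm K bs)
    plus-skipped bs with odd (count bs) in parity
    ... | true = ≅-refl
    ... | false = single-cong (j ∷ complementWord K bs) (*-congʳ (begin
      sgn (ell (false ∷ bs))          ≡⟨ P.cong sgn (ell-skipped bs) ⟩
      sgn (count bs ℕ.+ ell bs)       ≈⟨ sgn-shift (count bs) (ell bs) ⟩
      (if odd (count bs) then - 1# else 1#) * sgn (ell bs) ≡⟨ P.cong (λ b → (if b then - 1# else 1#) * sgn (ell bs)) parity ⟩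
      1# * sgn (ell bs)               ≈⟨ *-identityˡ _ ⟩
      sgn (ell bs)                    ∎))
      where open import Relation.Binary.Reasoning.Setoid setoid

    minus-skipped : ∀ bs → minusTerm (j ∷ K) (false ∷ bs) ≅ (- 1#) · lmul (j ∷ []) (minusTerm K bs)
    minus-skipped bs with odd (count bs) in parity
    ... | false = ≅-refl
    ... | true = single-cong (j ∷ complementWord K bs) (begin
      sgn (ell (false ∷ bs)) * p                           ≡⟨ P.cong (λ e → sgn e * p) (ell-skipped bs) ⟩
      sgn (count bs ℕ.+ ell bs) * p                        ≈⟨ *-congʳ (sgn-shift (count bs) (ell bs)) ⟩
      ((if odd (count bs) then - 1# else 1#) * sgn (ell bs)) * p ≡⟨ P.cong (λ b → ((if b then - 1# else 1#) * sgn (ell bs)) * p) parity ⟩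
      (- 1# * sgn (ell bs)) * p                            ≈⟨ *-assoc _ _ _ ⟩
      - 1# * (sgn (ell bs) * p)                            ∎)
      where
      open import Relation.Binary.Reasoning.Setoid setoid
      p : Carrier
      p = pow (- q) ((count bs ∸ 1) / 2)

    plus-chosen : ∀ bs → plusTerm (j ∷ K) (true ∷ bs) ≅ (- q) · minusTerm K bs
    plus-chosen bs with odd (count bs) in parity
    ... | false = ≅-refl
    ... | true = single-cong (complementWord K bs) (begin
      sgn (ell (true ∷ bs)) * pow (- q) (suc (count bs) / 2)   ≡⟨ P.cong₂ (λ e k → sgn e * pow (- q) k) (ell-chosen bs) (half-odd (count bs) parity) ⟩
      sgn (ell bs) * (- q * p)                                ≈⟨ solve 3 (λ a p q → a :* (:- q :* p) := :- q :* (a :* p)) ≈-refl (sgn (ell bs)) p q ⟩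
      - q * (sgn (ell bs) * p)                                ∎)
      where
      open import Relation.Binary.Reasoning.Setoid setoid
      p : Carrier
      p = pow (- q) ((count bs ∸ 1) / 2)

    minus-chosen : ∀ bs → minusTerm (j ∷ K) (true ∷ bs) ≅ plusTerm K bs
    minus-chosen bs with odd (count bs)
    ... | true = ≅-refl
    ... | false = ≅-reflexive (P.cong (λ e → ((sgn e * pow (- q) (count bs / 2)) , complementWord K bs) ∷ []) (ell-chosen bs))

    private
      double : List Bool → List (List Bool)
      double bs = (true ∷ bs) ∷ (false ∷ bs) ∷ []

      reorder : ∀ a b c d → a ⊕ (b ⊕ (c ⊕ d)) ≅ (b ⊕ c) ⊕ (a ⊕ d)
      reorder a b c d = compare-coefficients (` a ⊞ (` b ⊞ (` c ⊞ ` d))) ((` b ⊞ ` c) ⊞ (` a ⊞ ` d))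
        λ v → solve 4 (λ a b c d → a :+ (b :+ (c :+ d)) := (b :+ c) :+ (a :+ d)) ≈-refl _ _ _ _

    tPlus-cons : tPlusW (j ∷ K) ≅ lmul (j ∷ []) (tPlusW K) ⊕ ((- q) · tMinusW K)
    tPlus-cons = over (choices (length K))
      where
      over : ∀ L → concatMap (plusTerm (j ∷ K)) (concatMap double L)
                   ≅ lmul (j ∷ []) (concatMap (plusTerm K) L) ⊕ ((- q) · concatMap (minusTerm K) L)
      over [] = ≅-refl
      over (bs ∷ L) = begin
        plusTerm (j ∷ K) (true ∷ bs) ⊕ (plusTerm (j ∷ K) (false ∷ bs) ⊕ concatMap (plusTerm (j ∷ K)) (concatMap double L))
          ≈⟨ ⊕-cong (plus-chosen bs) (⊕-cong (plus-skipped bs) (over L)) ⟩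
        ((- q) · minusTerm K bs) ⊕ (lmul (j ∷ []) (plusTerm K bs) ⊕ (lmul (j ∷ []) (concatMap (plusTerm K) L) ⊕ ((- q) · concatMap (minusTerm K) L)))
          ≈⟨ reorder ((- q) · minusTerm K bs) (lmul (j ∷ []) (plusTerm K bs)) (lmul (j ∷ []) (concatMap (plusTerm K) L)) ((- q) · concatMap (minusTerm K) L) ⟩
        (lmul (j ∷ []) (plusTerm K bs) ⊕ lmul (j ∷ []) (concatMap (plusTerm K) L)) ⊕ (((- q) · minusTerm K bs) ⊕ ((- q) · concatMap (minusTerm K) L))
          ≡⟨ P.sym (P.cong₂ _⊕_ (lmul-⊕ (j ∷ []) (plusTerm K bs) (concatMap (plusTerm K) L)) (·-distrib-⊕ (- q) (minusTerm K bs) (concatMap (minusTerm K) L))) ⟩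
        lmul (j ∷ []) (plusTerm K bs ⊕ concatMap (plusTerm K) L) ⊕ ((- q) · (minusTerm K bs ⊕ concatMap (minusTerm K) L)) ∎
        where open ≅-Reasoning

    tMinus-cons : tMinusW (j ∷ K) ≅ ((- 1#) · lmul (j ∷ []) (tMinusW K)) ⊕ tPlusW K
    tMinus-cons = over (choices (length K))
      where
      over : ∀ L → concatMap (minusTerm (j ∷ K)) (concatMap double L)
                   ≅ ((- 1#) · lmul (j ∷ []) (concatMap (minusTerm K) L)) ⊕ concatMap (plusTerm K) L
      over [] = ≅-refl
      over (bs ∷ L) = begin
        minusTerm (j ∷ K) (true ∷ bs) ⊕ (minusTerm (j ∷ K) (false ∷ bs) ⊕ concatMap (minusTerm (j ∷ K)) (concatMap double L))
          ≈⟨ ⊕-cong (minus-chosen bs) (⊕-cong (minus-skipped bs) (over L)) ⟩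
        plusTerm K bs ⊕ (((- 1#) · lmul (j ∷ []) (minusTerm K bs)) ⊕ (((- 1#) · lmul (j ∷ []) (concatMap (minusTerm K) L)) ⊕ concatMap (plusTerm K) L))
          ≈⟨ reorder (plusTerm K bs) ((- 1#) · lmul (j ∷ []) (minusTerm K bs)) ((- 1#) · lmul (j ∷ []) (concatMap (minusTerm K) L)) (concatMap (plusTerm K) L) ⟩
        (((- 1#) · lmul (j ∷ []) (minusTerm K bs)) ⊕ ((- 1#) · lmul (j ∷ []) (concatMap (minusTerm K) L))) ⊕ (plusTerm K bs ⊕ concatMap (plusTerm K) L)
          ≡⟨ P.sym (P.cong (_⊕ (plusTerm K bs ⊕ concatMap (plusTerm K) L))
                (P.trans (P.cong ((- 1#) ·_) (lmul-⊕ (j ∷ []) (minusTerm K bs) (concatMap (minusTerm K) L)))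
                         (·-distrib-⊕ (- 1#) (lmul (j ∷ []) (minusTerm K bs)) (lmul (j ∷ []) (concatMap (minusTerm K) L))))) ⟩
        ((- 1#) · lmul (j ∷ []) (minusTerm K bs ⊕ concatMap (minusTerm K) L)) ⊕ (plusTerm K bs ⊕ concatMap (plusTerm K) L) ∎
        where open ≅-Reasoning

  -- Every word of t^±_K arises from K by deleting letters; deleting letters
  -- preserves being increasing and properties of all letters.
  complement-all : ∀ {P : Fin n → Set} K bs → All P K → All P (complementWord K bs)
  complement-all [] bs [] = []
  complement-all (k ∷ K) [] all = all
  complement-all (k ∷ K) (true ∷ bs) (_ ∷ all) = complement-all K bs all
  complement-all (k ∷ K) (false ∷ bs) (pk ∷ all) = pk ∷ complement-all K bs all

  complement-increasing : ∀ K bs → Increasing K → Increasing (complementWord K bs)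
  complement-increasing [] bs [] = []
  complement-increasing (j ∷ K) [] inc = inc
  complement-increasing (j ∷ K) (true ∷ bs) (_ ∷ inc) = complement-increasing K bs inc
  complement-increasing (j ∷ K) (false ∷ bs) (j<K ∷ inc) = complement-all K bs j<K ∷ complement-increasing K bs inc

  private
    over-choices : ∀ {Q} (term : List Bool → Poly) L →
      (∀ bs → Supported Q (term bs)) → Supported Q (concatMap term L)
    over-choices term [] each = []
    over-choices term (bs ∷ L) each = Supported-++ (term bs) _ (each bs) (over-choices term L each)

  tPlus-supported : ∀ {Q} K → (∀ bs → Q (complementWord K bs)) → Supported Q (tPlusW K)
  tPlus-supported {Q} K deleted = over-choices (plusTerm K) (choices (length K)) term
    where
    term : ∀ bs → Supported Q (plusTerm K bs)
    term bs with odd (count bs)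
    ... | true = []
    ... | false = deleted bs ∷ []

  tMinus-supported : ∀ {Q} K → (∀ bs → Q (complementWord K bs)) → Supported Q (tMinusW K)
  tMinus-supported {Q} K deleted = over-choices (minusTerm K) (choices (length K)) term
    where
    term : ∀ bs → Supported Q (minusTerm K bs)
    term bs with odd (count bs)
    ... | true = deleted bs ∷ []
    ... | false = []

module GeneratorTimesSignedSums {c ℓ} (R : CommutativeRing c ℓ) (n : ℕ) (q : CommutativeRing.Carrier R) (s : Fin n) where
  open CommutativeRing R renaming (refl to ≈-refl)
  open FreeAlg R n
  open Polynomials R n
  open NormalForm R n q s
  open SignedSums R n q
  open IntegerCoefficients R using (solve; _:=_; _:+_; _:*_; :-_; con)
  open ≅-Reasoning

  NF-tPlus-cons : ∀ j K → NF (tPlusW (j ∷ K)) ≅ NF (lmul (j ∷ []) (tPlusW K)) ⊕ ((- q) · NF (tMinusW K))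
  NF-tPlus-cons j K = ≅-trans (extend-cong nf (NewFirstLetter.tPlus-cons j K))
    (≅-trans (extend-⊕ nf (lmul (j ∷ []) (tPlusW K)) _) (⊕-cong ≅-refl (extend-· nf (- q) (tMinusW K))))

  NF-tMinus-cons : ∀ j K → NF (tMinusW (j ∷ K)) ≅ ((- 1#) · NF (lmul (j ∷ []) (tMinusW K))) ⊕ NF (tPlusW K)
  NF-tMinus-cons j K = ≅-trans (extend-cong nf (NewFirstLetter.tMinus-cons j K))
    (≅-trans (extend-⊕ nf ((- 1#) · lmul (j ∷ []) (tMinusW K)) _) (⊕-cong (extend-· nf (- 1#) (lmul (j ∷ []) (tMinusW K))) ≅-refl))

  NF-tPlus-below : ∀ {j} → j Fin.< s → ∀ K →
    NF (tPlusW (j ∷ K)) ≅ (((- 1#) · lmul (j ∷ []) (NF (tPlusW K))) ⊕ ((q + q) · tPlusW K)) ⊕ ((- q) · NF (tMinusW K))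
  NF-tPlus-below j<s K = ≅-trans (NF-tPlus-cons _ K) (⊕-cong (NF-lmul-below j<s (tPlusW K)) ≅-refl)

  NF-tMinus-below : ∀ {j} → j Fin.< s → ∀ K →
    NF (tMinusW (j ∷ K)) ≅ ((- 1#) · (((- 1#) · lmul (j ∷ []) (NF (tMinusW K))) ⊕ ((q + q) · tMinusW K))) ⊕ NF (tPlusW K)
  NF-tMinus-below j<s K = ≅-trans (NF-tMinus-cons _ K) (⊕-cong (·-congˡ (- 1#) (NF-lmul-below j<s (tMinusW K))) ≅-refl)

  NF-above : ∀ K → All (s Fin.<_) K → NF (tPlusW K) ≅ lmul (s ∷ []) (tPlusW K) × NF (tMinusW K) ≅ lmul (s ∷ []) (tMinusW K)
  NF-above K s<K = NF-all-above (tPlusW K) (tPlus-supported K (λ bs → complement-all K bs s<K))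
                 , NF-all-above (tMinusW K) (tMinus-supported K (λ bs → complement-all K bs s<K))

  NF-member : ∀ b a → All (Fin._< s) b → All (s Fin.<_) a →
    NF (tPlusW (b ++ s ∷ a)) ≅ q · tMinusW (b ++ s ∷ a) × NF (tMinusW (b ++ s ∷ a)) ≅ tPlusW (b ++ s ∷ a)
  NF-member [] K [] s<K = plus , minus
    where
    PK MK : Poly
    PK = tPlusW K
    MK = tMinusW K
    plus : NF (tPlusW (s ∷ K)) ≅ q · tMinusW (s ∷ K)
    plus = begin
      NF (tPlusW (s ∷ K))                                  ≈⟨ NF-tPlus-cons s K ⟩
      NF (lmul (s ∷ []) PK) ⊕ ((- q) · NF MK)              ≈⟨ ⊕-cong (NF-lmul-self PK) (·-congˡ (- q) (proj₂ (NF-above K s<K))) ⟩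
      (q · PK) ⊕ ((- q) · lmul (s ∷ []) MK)                ≈⟨ compare-coefficients (q ⊠ ` PK ⊞ (- q) ⊠ ` lmul (s ∷ []) MK) (q ⊠ ((- 1#) ⊠ ` lmul (s ∷ []) MK ⊞ ` PK))
                                                                (λ v → identity q (coeff PK v) (coeff (lmul (s ∷ []) MK) v)) ⟩
      q · (((- 1#) · lmul (s ∷ []) MK) ⊕ PK)               ≈⟨ ·-congˡ q (≅-sym (NewFirstLetter.tMinus-cons s K)) ⟩
      q · tMinusW (s ∷ K)                                  ∎
      where
      identity : ∀ q a b → q * a + - q * b ≈ q * (- 1# * b + a)
      identity = solve 3 (λ q a b → q :* a :+ :- q :* b := q :* (:- con (ℤ.+ 1) :* b :+ a)) ≈-refl
    minus : NF (tMinusW (s ∷ K)) ≅ tPlusW (s ∷ K)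
    minus = begin
      NF (tMinusW (s ∷ K))                                 ≈⟨ NF-tMinus-cons s K ⟩
      ((- 1#) · NF (lmul (s ∷ []) MK)) ⊕ NF PK             ≈⟨ ⊕-cong (·-congˡ (- 1#) (NF-lmul-self MK)) (proj₁ (NF-above K s<K)) ⟩
      ((- 1#) · (q · MK)) ⊕ lmul (s ∷ []) PK               ≈⟨ compare-coefficients ((- 1#) ⊠ q ⊠ ` MK ⊞ ` lmul (s ∷ []) PK) (` lmul (s ∷ []) PK ⊞ (- q) ⊠ ` MK)
                                                                (λ v → identity q (coeff MK v) (coeff (lmul (s ∷ []) PK) v)) ⟩
      lmul (s ∷ []) PK ⊕ ((- q) · MK)                      ≈⟨ ≅-sym (NewFirstLetter.tPlus-cons s K) ⟩
      tPlusW (s ∷ K)                                       ∎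
      where
      identity : ∀ q b a → - 1# * (q * b) + a ≈ a + - q * b
      identity = solve 3 (λ q b a → :- con (ℤ.+ 1) :* (q :* b) :+ a := a :+ :- q :* b) ≈-refl
  NF-member (j ∷ b) a (j<s ∷ b<s) s<a = plus , minus
    where
    K : Word
    K = b ++ s ∷ a
    PK MK : Poly
    PK = tPlusW K
    MK = tMinusW K
    IH : NF PK ≅ q · MK × NF MK ≅ PK
    IH = NF-member b a b<s s<a
    plus : NF (tPlusW (j ∷ K)) ≅ q · tMinusW (j ∷ K)
    plus = begin
      NF (tPlusW (j ∷ K))                                                                   ≈⟨ NF-tPlus-below j<s K ⟩
      (((- 1#) · lmul (j ∷ []) (NF PK)) ⊕ ((q + q) · PK)) ⊕ ((- q) · NF MK)                 ≈⟨ ⊕-cong (⊕-cong (·-congˡ (- 1#) (lmul-cong (j ∷ []) (proj₁ IH))) ≅-refl) (·-congˡ (- q) (proj₂ IH)) ⟩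
      (((- 1#) · lmul (j ∷ []) (q · MK)) ⊕ ((q + q) · PK)) ⊕ ((- q) · PK)                   ≡⟨ P.cong (λ X → (((- 1#) · X) ⊕ ((q + q) · PK)) ⊕ ((- q) · PK)) (lmul-· (j ∷ []) q MK) ⟩
      (((- 1#) · (q · lmul (j ∷ []) MK)) ⊕ ((q + q) · PK)) ⊕ ((- q) · PK)                   ≈⟨ compare-coefficients ((- 1#) ⊠ q ⊠ ` lmul (j ∷ []) MK ⊞ (q + q) ⊠ ` PK ⊞ (- q) ⊠ ` PK) (q ⊠ ((- 1#) ⊠ ` lmul (j ∷ []) MK ⊞ ` PK))
                                                                                                (λ v → identity q (coeff (lmul (j ∷ []) MK) v) (coeff PK v)) ⟩
      q · (((- 1#) · lmul (j ∷ []) MK) ⊕ PK)                                                ≈⟨ ·-congˡ q (≅-sym (NewFirstLetter.tMinus-cons j K)) ⟩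
      q · tMinusW (j ∷ K)                                                                   ∎
      where
      identity : ∀ q m p → - 1# * (q * m) + (q + q) * p + - q * p ≈ q * (- 1# * m + p)
      identity = solve 3 (λ q m p → :- con (ℤ.+ 1) :* (q :* m) :+ (q :+ q) :* p :+ :- q :* p := q :* (:- con (ℤ.+ 1) :* m :+ p)) ≈-refl
    minus : NF (tMinusW (j ∷ K)) ≅ tPlusW (j ∷ K)
    minus = begin
      NF (tMinusW (j ∷ K))                                                                  ≈⟨ NF-tMinus-below j<s K ⟩
      ((- 1#) · (((- 1#) · lmul (j ∷ []) (NF MK)) ⊕ ((q + q) · MK))) ⊕ NF PK                ≈⟨ ⊕-cong (·-congˡ (- 1#) (⊕-cong (·-congˡ (- 1#) (lmul-cong (j ∷ []) (proj₂ IH))) ≅-refl)) (proj₁ IH) ⟩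
      ((- 1#) · (((- 1#) · lmul (j ∷ []) PK) ⊕ ((q + q) · MK))) ⊕ (q · MK)                  ≈⟨ compare-coefficients ((- 1#) ⊠ ((- 1#) ⊠ ` lmul (j ∷ []) PK ⊞ (q + q) ⊠ ` MK) ⊞ q ⊠ ` MK) (` lmul (j ∷ []) PK ⊞ (- q) ⊠ ` MK)
                                                                                                (λ v → identity q (coeff (lmul (j ∷ []) PK) v) (coeff MK v)) ⟩
      lmul (j ∷ []) PK ⊕ ((- q) · MK)                                                       ≈⟨ ≅-sym (NewFirstLetter.tPlus-cons j K) ⟩
      tPlusW (j ∷ K)                                                                        ∎
      where
      identity : ∀ q p m → - 1# * (- 1# * p + (q + q) * m) + q * m ≈ p + - q * m
      identity = solve 3 (λ q p m → :- con (ℤ.+ 1) :* (:- con (ℤ.+ 1) :* p :+ (q :+ q) :* m) :+ q :* m := p :+ :- q :* m) ≈-refl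

  NF-nonmember : ∀ b a → All (Fin._< s) b → All (s Fin.<_) a →
    NF (tPlusW (b ++ a)) ≅ (sgn (length b) · tPlusW (b ++ s ∷ a)) ⊕ (q · tMinusW (b ++ a))
    × NF (tMinusW (b ++ a)) ≅ ((- sgn (length b)) · tMinusW (b ++ s ∷ a)) ⊕ tPlusW (b ++ a)
  NF-nonmember [] K [] s<K = plus , minus
    where
    PK MK : Poly
    PK = tPlusW K
    MK = tMinusW K
    plus : NF PK ≅ (sgn 0 · tPlusW (s ∷ K)) ⊕ (q · MK)
    plus = begin
      NF PK                                                 ≈⟨ proj₁ (NF-above K s<K) ⟩
      lmul (s ∷ []) PK                                      ≈⟨ compare-coefficients (` lmul (s ∷ []) PK) (1# ⊠ (` lmul (s ∷ []) PK ⊞ (- q) ⊠ ` MK) ⊞ q ⊠ ` MK)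
                                                                 (λ v → identity q (coeff (lmul (s ∷ []) PK) v) (coeff MK v)) ⟩
      (1# · (lmul (s ∷ []) PK ⊕ ((- q) · MK))) ⊕ (q · MK)   ≈⟨ ⊕-cong (·-congˡ 1# (≅-sym (NewFirstLetter.tPlus-cons s K))) ≅-refl ⟩
      (sgn 0 · tPlusW (s ∷ K)) ⊕ (q · MK)                   ∎
      where
      identity : ∀ q p m → p ≈ 1# * (p + - q * m) + q * m
      identity = solve 3 (λ q p m → p := con (ℤ.+ 1) :* (p :+ :- q :* m) :+ q :* m) ≈-refl
    minus : NF MK ≅ ((- sgn 0) · tMinusW (s ∷ K)) ⊕ PK
    minus = begin
      NF MK                                                 ≈⟨ proj₂ (NF-above K s<K) ⟩
      lmul (s ∷ []) MK                                      ≈⟨ compare-coefficients (` lmul (s ∷ []) MK) ((- 1#) ⊠ ((- 1#) ⊠ ` lmul (s ∷ []) MK ⊞ ` PK) ⊞ ` PK)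
                                                                 (λ v → identity (coeff (lmul (s ∷ []) MK) v) (coeff PK v)) ⟩
      ((- 1#) · (((- 1#) · lmul (s ∷ []) MK) ⊕ PK)) ⊕ PK    ≈⟨ ⊕-cong (·-congˡ (- 1#) (≅-sym (NewFirstLetter.tMinus-cons s K))) ≅-refl ⟩
      ((- sgn 0) · tMinusW (s ∷ K)) ⊕ PK                    ∎
      where
      identity : ∀ m p → m ≈ - 1# * (- 1# * m + p) + p
      identity = solve 2 (λ m p → m := :- con (ℤ.+ 1) :* (:- con (ℤ.+ 1) :* m :+ p) :+ p) ≈-refl
  NF-nonmember (j ∷ b) a (j<s ∷ b<s) s<a = plus , minus
    where
    K K' : Word
    K = b ++ a
    K' = b ++ s ∷ a
    PK MK : Poly
    PK = tPlusW K
    MK = tMinusW K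
    PK' MK' : Poly
    PK' = tPlusW K'
    MK' = tMinusW K'
    σ : Carrier
    σ = sgn (length b)
    IH : NF PK ≅ (σ · PK') ⊕ (q · MK) × NF MK ≅ ((- σ) · MK') ⊕ PK
    IH = NF-nonmember b a b<s s<a
    plus : NF (tPlusW (j ∷ K)) ≅ (sgn (suc (length b)) · tPlusW (j ∷ K')) ⊕ (q · tMinusW (j ∷ K))
    plus = begin
      NF (tPlusW (j ∷ K))
        ≈⟨ NF-tPlus-below j<s K ⟩
      (((- 1#) · lmul (j ∷ []) (NF PK)) ⊕ ((q + q) · PK)) ⊕ ((- q) · NF MK)
        ≈⟨ ⊕-cong (⊕-cong (·-congˡ (- 1#) (lmul-cong (j ∷ []) (proj₁ IH))) ≅-refl) (·-congˡ (- q) (proj₂ IH)) ⟩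
      (((- 1#) · lmul (j ∷ []) ((σ · PK') ⊕ (q · MK))) ⊕ ((q + q) · PK)) ⊕ ((- q) · (((- σ) · MK') ⊕ PK))
        ≡⟨ P.cong (λ X → (((- 1#) · X) ⊕ ((q + q) · PK)) ⊕ ((- q) · (((- σ) · MK') ⊕ PK)))
                  (P.trans (lmul-⊕ (j ∷ []) (σ · PK') (q · MK)) (P.cong₂ _⊕_ (lmul-· (j ∷ []) σ PK') (lmul-· (j ∷ []) q MK))) ⟩
      (((- 1#) · ((σ · lmul (j ∷ []) PK') ⊕ (q · lmul (j ∷ []) MK))) ⊕ ((q + q) · PK)) ⊕ ((- q) · (((- σ) · MK') ⊕ PK))
        ≈⟨ compare-coefficients ((- 1#) ⊠ (σ ⊠ ` lmul (j ∷ []) PK' ⊞ q ⊠ ` lmul (j ∷ []) MK) ⊞ (q + q) ⊠ ` PK ⊞ (- q) ⊠ ((- σ) ⊠ ` MK' ⊞ ` PK))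
                                ((- 1# * σ) ⊠ (` lmul (j ∷ []) PK' ⊞ (- q) ⊠ ` MK') ⊞ q ⊠ ((- 1#) ⊠ ` lmul (j ∷ []) MK ⊞ ` PK))
             (λ v → identity σ q (coeff (lmul (j ∷ []) PK') v) (coeff (lmul (j ∷ []) MK) v) (coeff PK v) (coeff MK' v)) ⟩
      (sgn (suc (length b)) · (lmul (j ∷ []) PK' ⊕ ((- q) · MK'))) ⊕ (q · (((- 1#) · lmul (j ∷ []) MK) ⊕ PK))
        ≈⟨ ⊕-cong (·-congˡ _ (≅-sym (NewFirstLetter.tPlus-cons j K'))) (·-congˡ q (≅-sym (NewFirstLetter.tMinus-cons j K))) ⟩
      (sgn (suc (length b)) · tPlusW (j ∷ K')) ⊕ (q · tMinusW (j ∷ K))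
        ∎
      where
      identity : ∀ σ q p' m p m' → - 1# * (σ * p' + q * m) + (q + q) * p + - q * (- σ * m' + p)
                                   ≈ (- 1# * σ) * (p' + - q * m') + q * (- 1# * m + p)
      identity = solve 6 (λ σ q p' m p m' → :- con (ℤ.+ 1) :* (σ :* p' :+ q :* m) :+ (q :+ q) :* p :+ :- q :* (:- σ :* m' :+ p)
                                          := (:- con (ℤ.+ 1) :* σ) :* (p' :+ :- q :* m') :+ q :* (:- con (ℤ.+ 1) :* m :+ p)) ≈-refl
    minus : NF (tMinusW (j ∷ K)) ≅ ((- sgn (suc (length b))) · tMinusW (j ∷ K')) ⊕ tPlusW (j ∷ K)
    minus = begin
      NF (tMinusW (j ∷ K))
        ≈⟨ NF-tMinus-below j<s K ⟩
      ((- 1#) · (((- 1#) · lmul (j ∷ []) (NF MK)) ⊕ ((q + q) · MK))) ⊕ NF PK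
        ≈⟨ ⊕-cong (·-congˡ (- 1#) (⊕-cong (·-congˡ (- 1#) (lmul-cong (j ∷ []) (proj₂ IH))) ≅-refl)) (proj₁ IH) ⟩
      ((- 1#) · (((- 1#) · lmul (j ∷ []) (((- σ) · MK') ⊕ PK)) ⊕ ((q + q) · MK))) ⊕ ((σ · PK') ⊕ (q · MK))
        ≡⟨ P.cong (λ X → ((- 1#) · (((- 1#) · X) ⊕ ((q + q) · MK))) ⊕ ((σ · PK') ⊕ (q · MK)))
                  (P.trans (lmul-⊕ (j ∷ []) ((- σ) · MK') PK) (P.cong (_⊕ lmul (j ∷ []) PK) (lmul-· (j ∷ []) (- σ) MK'))) ⟩
      ((- 1#) · (((- 1#) · (((- σ) · lmul (j ∷ []) MK') ⊕ lmul (j ∷ []) PK)) ⊕ ((q + q) · MK))) ⊕ ((σ · PK') ⊕ (q · MK))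
        ≈⟨ compare-coefficients ((- 1#) ⊠ ((- 1#) ⊠ ((- σ) ⊠ ` lmul (j ∷ []) MK' ⊞ ` lmul (j ∷ []) PK) ⊞ (q + q) ⊠ ` MK) ⊞ (σ ⊠ ` PK' ⊞ q ⊠ ` MK))
                                ((- (- 1# * σ)) ⊠ ((- 1#) ⊠ ` lmul (j ∷ []) MK' ⊞ ` PK') ⊞ (` lmul (j ∷ []) PK ⊞ (- q) ⊠ ` MK))
             (λ v → identity σ q (coeff (lmul (j ∷ []) MK') v) (coeff (lmul (j ∷ []) PK) v) (coeff MK v) (coeff PK' v)) ⟩
      ((- sgn (suc (length b))) · (((- 1#) · lmul (j ∷ []) MK') ⊕ PK')) ⊕ (lmul (j ∷ []) PK ⊕ ((- q) · MK))
        ≈⟨ ⊕-cong (·-congˡ _ (≅-sym (NewFirstLetter.tMinus-cons j K'))) (≅-sym (NewFirstLetter.tPlus-cons j K)) ⟩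
      ((- sgn (suc (length b))) · tMinusW (j ∷ K')) ⊕ tPlusW (j ∷ K)
        ∎
      where
      identity : ∀ σ q m' p m p' → - 1# * (- 1# * (- σ * m' + p) + (q + q) * m) + (σ * p' + q * m)
                                   ≈ - (- 1# * σ) * (- 1# * m' + p') + (p + - q * m)
      identity = solve 6 (λ σ q m' p m p' → :- con (ℤ.+ 1) :* (:- con (ℤ.+ 1) :* (:- σ :* m' :+ p) :+ (q :+ q) :* m) :+ (σ :* p' :+ q :* m)
                                          := :- (:- con (ℤ.+ 1) :* σ) :* (:- con (ℤ.+ 1) :* m' :+ p') :+ (p :+ :- q :* m)) ≈-refl

  NF-∈ : ∀ J → s ∈ J → NF (tPlusW (elems J)) ≅ q · tMinusW (elems J) × NF (tMinusW (elems J)) ≅ tPlusW (elems J)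
  NF-∈ J s∈J with split-∈ J s s∈J
  ... | sp , eq rewrite eq = NF-member (below sp) (above sp) (below<s sp) (s<above sp)

  NF-∉ : ∀ J → s ∉ J →
    NF (tPlusW (elems J)) ≅ (sgn (#below J s) · tPlusW (elems (J ∪ ⁅ s ⁆))) ⊕ (q · tMinusW (elems J))
    × NF (tMinusW (elems J)) ≅ ((- sgn (#below J s)) · tMinusW (elems (J ∪ ⁅ s ⁆))) ⊕ tPlusW (elems J)
  NF-∉ J s∉J with split-∉ J s s∉J
  ... | sp , eq , eq∪ rewrite #below-split J sp eq | eq | eq∪ = NF-nonmember (below sp) (above sp) (below<s sp) (s<above sp)

open FreeAlg using (Reduces; t_⊛_; tPlus; tMinus; _·_; _⊕_; sgn)

lemma3p5 : ∀ {c ℓ} (R : CommutativeRing c ℓ) (n : ℕ) (q : CommutativeRing.Carrier R)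
           (J : Subset n) (s : Fin n) →
           (s ∈ J →
             Reduces R n q (t_⊛_ R n s (tPlus R n q J)) (_·_ R n q (tMinus R n q J))
             × Reduces R n q (t_⊛_ R n s (tMinus R n q J)) (tPlus R n q J))
           × (s ∉ J →
             Reduces R n q (t_⊛_ R n s (tPlus R n q J))
               (_⊕_ R n (_·_ R n (sgn R n (#below J s)) (tPlus R n q (J ∪ ⁅ s ⁆)))
                        (_·_ R n q (tMinus R n q J)))
             × Reduces R n q (t_⊛_ R n s (tMinus R n q J))
               (_⊕_ R n (_·_ R n (CommutativeRing.-_ R (sgn R n (#below J s))) (tMinus R n q (J ∪ ⁅ s ⁆)))
                        (tPlus R n q J)))
lemma3p5 R n q J s = (λ s∈J → reduce-both (NF-∈ J s∈J)) , (λ s∉J → reduce-both (NF-∉ J s∉J))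
  where
  open Polynomials R n using (_≅_)
  open NormalForm R n q s using (NF; reduces-to-NF)
  open SignedSums R n q using (tPlusW; tMinusW; tPlus-supported; tMinus-supported; complement-increasing)
  open GeneratorTimesSignedSums R n q s using (NF-∈; NF-∉)
  K : List (Fin n)
  K = elems J
  reduce-both : ∀ {h h'} → NF (tPlusW K) ≅ h × NF (tMinusW K) ≅ h' →
                Reduces R n q (t_⊛_ R n s (tPlus R n q J)) h × Reduces R n q (t_⊛_ R n s (tMinus R n q J)) h'
  reduce-both (plus , minus) =
    reduces-to-NF (tPlusW K) (tPlus-supported K λ bs → complement-increasing K bs (elems-increasing J)) plus ,
    reduces-to-NF (tMinusW K) (tMinus-supported K λ bs → complement-increasing K bs (elems-increasing J)) minus
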